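{- Let $q'$ be a prime power and $q=(q')^{3}$. Then $PG(3,q)$ contains a $2$-saturating set of size $4q'+4$ consisting of four pairwise skew lines of the subgeometry $PG(3,q')\subset PG(3,q)$.
   Context: The subgeometry $PG(3,q')\subset PG(3,q)$ consists of the points admitting homogeneous coordinates with all entries in $F_{q'}$; a line of $PG(3,q')$ means its set of $q'+1$ points in this subgeometry. A point set $S\subseteq PG(v,q)$ is $\varrho$-saturating if for every point $x\in PG(v,q)$ there exist $\varrho+1$ points of $S$ generating a subspace containing $x$, and $\varrho$ is the smallest value with this property. -}

module Defs where

open import Level using (0ℓ)
open import Data.Nat as ℕ using (ℕ; zero; suc; _^_)
open import Data.Nat.Primality using (Prime)
open import Data.Fin using (Fin; zero; suc)
open import Data.Product using (Σ; ∃; _×_; _,_)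
open import Relation.Binary.PropositionalEquality using (_≡_; _≢_)
open import Relation.Nullary using (¬_)
open import Data.Empty using (⊥)
open import Algebra.Core using (Op₁; Op₂)
open import Algebra.Structures using (IsCommutativeRing)

IsPrimePower : ℕ → Set
IsPrimePower q = Σ ℕ λ p → Σ ℕ λ k → Prime p × q ≡ p ^ suc k

record Field : Set₁ where
  infixl 7 _*_
  infixl 6 _+_
  field
    Carrier : Set
    _+_ _*_ : Op₂ Carrier
    -_      : Op₁ Carrier
    0# 1#   : Carrier
    isCommutativeRing : IsCommutativeRing _≡_ _+_ _*_ -_ 0# 1#
    0≢1     : 0# ≢ 1#
    inverse : ∀ x → x ≢ 0# → Σ Carrier λ y → x * y ≡ 1#

HasSize : Set → ℕ → Set
HasSize A n = Σ (Fin n → A) λ e →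
  (∀ i j → e i ≡ e j → i ≡ j) × (∀ x → Σ (Fin n) λ i → e i ≡ x)

module _ (F : Field) where
  open Field F

  record Subfield : Set₁ where
    field
      In    : Carrier → Set
      In-0  : In 0#
      In-1  : In 1#
      In-+  : ∀ {x y} → In x → In y → In (x + y)
      In--  : ∀ {x} → In x → In (- x)
      In-*  : ∀ {x y} → In x → In y → In (x * y)
      In-⁻¹ : ∀ {x y} → In x → x * y ≡ 1# → In y

  SubHasSize : Subfield → ℕ → Set
  SubHasSize K n = Σ (Fin n → Carrier) λ e →
    (∀ i → Subfield.In K (e i)) ×
    (∀ i j → e i ≡ e j → i ≡ j) ×
    (∀ x → Subfield.In K x → Σ (Fin n) λ i → e i ≡ x)

  -- Vectors of F^4 (homogeneous coordinates of PG(3,q)).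
  V4 : Set
  V4 = Fin 4 → Carrier

  NonZero : V4 → Set
  NonZero x = ¬ (∀ i → x i ≡ 0#)

  _∼_ : V4 → V4 → Set
  x ∼ y = Σ Carrier λ c → c ≢ 0# × (∀ i → x i ≡ c * y i)

  sumF : ∀ {m} → (Fin m → Carrier) → Carrier
  sumF {zero}  f = 0#
  sumF {suc m} f = f zero + sumF (λ i → f (suc i))

  InSpan : V4 → ∀ {m} → (Fin m → V4) → Set
  InSpan x {m} ws = Σ (Fin m → Carrier) λ c → ∀ i → x i ≡ sumF (λ j → c j * ws j i)

  -- A point set S of PG(3,q), given as a predicate on nonzero vectors
  -- (representatives of its points).
  -- S is ρ-covering: every point lies in a subspace generated by ρ+1 points of S.
  Covering : (V4 → Set) → ℕ → Set
  Covering S ρ = ∀ x → NonZero x →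
    Σ (Fin (suc ρ) → V4) λ s → (∀ j → NonZero (s j) × S (s j)) × InSpan x s

  Saturating : (V4 → Set) → ℕ → Set
  Saturating S ρ = Covering S ρ × (∀ ρ' → ρ' ℕ.< ρ → ¬ Covering S ρ')

  HasPointCount : (V4 → Set) → ℕ → Set
  HasPointCount S n = Σ (Fin n → V4) λ e →
    (∀ i → NonZero (e i) × S (e i)) ×
    (∀ i j → e i ∼ e j → i ≡ j) ×
    (∀ x → NonZero x → S x → Σ (Fin n) λ i → x ∼ e i)

  module _ (K : Subfield) where
    open Subfield K

    record SubLine : Set where
      field
        u v   : V4
        u-In  : ∀ i → In (u i)
        v-In  : ∀ i → In (v i)
        indep : ∀ a b → In a → In b → (∀ i → a * u i + b * v i ≡ 0#) →
                a ≡ 0# × b ≡ 0#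

    -- x (nonzero) represents one of the q'+1 points of the line l
    -- (points of the subgeometry on l)
    OnLine : SubLine → V4 → Set
    OnLine l x = NonZero x × Σ Carrier λ a → Σ Carrier λ b →
      In a × In b × x ∼ (λ i → a * SubLine.u l i + b * SubLine.v l i)

    Skew : SubLine → SubLine → Set
    Skew l m = ∀ x → OnLine l x → OnLine m x → ⊥

    UnionOf : ∀ {k} → (Fin k → SubLine) → V4 → Set
    UnionOf L x = Σ _ λ i → OnLine (L i) x

module Submission where

-- Let K = F_q′ ⊂ F = F_q, pick β, γ with 1, β, γ a basis of F over K, and X² − pX + r irreducible over K.
-- The lines ⟨e₀, e₁⟩, ⟨e₂, e₃⟩, ⟨e₀ + e₂, e₁ + e₃⟩, ⟨e₀ + e₃, e₁ − r e₂ + p e₃⟩ of PG(3, q′) are pairwise skew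
-- (their spanning vectors have nonzero determinants), so they carry 4 (q′ + 1) points.
-- Any point x lies in a K-rational plane c · x = 0: expanding the coordinates of x in the basis 1, β, γ gives
-- three K-linear equations in the four unknowns c. Each line meets that plane in a K-point, and since the
-- quadratic has no root in K, three of these points have a nonzero cofactor, so they span the plane and x.
-- On the other hand (1, β, γ, 0) is on no line through two K-points: expanding the two coefficients in the
-- basis would write the 3 × 3 identity matrix as a sum of two matrices of rank one.

open import Defs
open import Level using (0ℓ)
open import Algebra.Bundles using (CommutativeRing; RawRing)
import Algebra.Solver.Ring.AlmostCommutativeRing as ACR
open import Data.Nat as ℕ using (ℕ; zero; suc; _^_; s≤s; z≤n)
import Data.Nat.Properties as ℕ
open import Data.Nat.Primality using (prime⇒nonTrivial)
open import Data.Integer as ℤ using (ℤ)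
import Data.Integer.Properties as ℤ
open import Data.Sign as Sign using (Sign)
open import Data.Fin using (Fin; zero; suc; combine; remQuot; punchIn; punchOut; inject₁; _↑ˡ_; _↑ʳ_)
open import Data.Fin.Patterns using (0F; 1F; 2F; 3F; 4F)
open import Data.Fin.Properties
  using (any?; all?; ¬∀⟶∃¬; injective⇒≤; punchIn-punchOut; punchOut-injective; remQuot-combine; combine-remQuot)
import Data.Fin.Properties as Fin
import Data.Maybe as Maybe
open import Data.Product using (Σ; _×_; _,_; proj₁; proj₂)
open import Data.Product.Properties using (≡-dec)
open import Data.Sum using (_⊎_; inj₁; inj₂)
open import Data.Empty using (⊥; ⊥-elim)
import Data.Vec as Vec
open import Data.Vec.Functional using (_∷_; [])
open import Relation.Nullary using (¬_; yes; no)
open import Relation.Nullary.Decidable using (dec⇒maybe; _×-dec_)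
open import Relation.Binary.Definitions using (DecidableEquality)
open import Relation.Binary.PropositionalEquality

-- The ring solver of Algebra.Solver.Ring with integer coefficients, which needs no decidable equality on R.
module ℤ-Solver {c ℓ} (R : CommutativeRing c ℓ) where
  private module R = CommutativeRing R
  open R hiding (refl; sym; trans; reflexive; setoid)
  open import Algebra.Properties.Ring ring using (-‿distribˡ-*; -‿involutive; -‿+-comm; -0#≈0#)
  open import Algebra.Properties.Semiring.Mult.TCOptimised semiring using (×-homo-+; ×1-homo-*)
    renaming (_×_ to _×′_)
  open import Relation.Binary.Reasoning.Setoid R.setoid

  -- the optimised _×′_ has 1 ×′ x = x, so the constants of a polynomial evaluate to 0# and 1# definitionally
  ⟦_⟧ℤ : ℤ → Carrier
  ⟦ ℤ.+ n ⟧ℤ = n ×′ 1#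
  ⟦ ℤ.-[1+ n ] ⟧ℤ = - (suc n ×′ 1#)

  private
    suc× : ∀ n → suc n ×′ 1# ≈ 1# + n ×′ 1#
    suc× = ×-homo-+ 1# 1

    sign : Sign → Carrier
    sign Sign.+ = 1#
    sign Sign.- = - 1#

    -1*x≈-x : ∀ x → - 1# * x ≈ - x
    -1*x≈-x x = R.trans (R.sym (-‿distribˡ-* 1# x)) (-‿cong (*-identityˡ x))

    sign-homo : ∀ s t → sign (s Sign.* t) ≈ sign s * sign t
    sign-homo Sign.+ t = R.sym (*-identityˡ _)
    sign-homo Sign.- Sign.+ = R.sym (*-identityʳ _)
    sign-homo Sign.- Sign.- = R.sym (R.trans (-1*x≈-x _) (-‿involutive _))

    ◃-homo : ∀ s n → ⟦ s ℤ.◃ n ⟧ℤ ≈ sign s * n ×′ 1#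
    ◃-homo Sign.+ zero = R.sym (zeroʳ _)
    ◃-homo Sign.- zero = R.sym (zeroʳ _)
    ◃-homo Sign.+ (suc n) = R.sym (*-identityˡ _)
    ◃-homo Sign.- (suc n) = R.sym (-1*x≈-x _)

    sign-abs : ∀ i → ⟦ i ⟧ℤ ≈ sign (ℤ.sign i) * ℤ.∣ i ∣ ×′ 1#
    sign-abs (ℤ.+ n) = R.sym (*-identityˡ _)
    sign-abs ℤ.-[1+ n ] = R.sym (-1*x≈-x _)

    interchange : ∀ a b x y → (a * b) * (x * y) ≈ (a * x) * (b * y)
    interchange a b x y = begin
      (a * b) * (x * y) ≈⟨ *-assoc a b (x * y) ⟩
      a * (b * (x * y)) ≈⟨ *-congˡ (R.trans (R.sym (*-assoc b x y)) (*-congʳ (*-comm b x))) ⟩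
      a * ((x * b) * y) ≈⟨ *-congˡ (*-assoc x b y) ⟩
      a * (x * (b * y)) ≈⟨ R.sym (*-assoc a x (b * y)) ⟩
      (a * x) * (b * y) ∎

    *-homo : ∀ i j → ⟦ i ℤ.* j ⟧ℤ ≈ ⟦ i ⟧ℤ * ⟦ j ⟧ℤ
    *-homo i j = begin
      ⟦ (ℤ.sign i Sign.* ℤ.sign j) ℤ.◃ (ℤ.∣ i ∣ ℕ.* ℤ.∣ j ∣) ⟧ℤ
        ≈⟨ ◃-homo (ℤ.sign i Sign.* ℤ.sign j) (ℤ.∣ i ∣ ℕ.* ℤ.∣ j ∣) ⟩
      sign (ℤ.sign i Sign.* ℤ.sign j) * (ℤ.∣ i ∣ ℕ.* ℤ.∣ j ∣) ×′ 1#
        ≈⟨ *-cong (sign-homo (ℤ.sign i) (ℤ.sign j)) (×1-homo-* ℤ.∣ i ∣ ℤ.∣ j ∣) ⟩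
      (sign (ℤ.sign i) * sign (ℤ.sign j)) * (ℤ.∣ i ∣ ×′ 1# * ℤ.∣ j ∣ ×′ 1#)
        ≈⟨ interchange _ _ _ _ ⟩
      (sign (ℤ.sign i) * ℤ.∣ i ∣ ×′ 1#) * (sign (ℤ.sign j) * ℤ.∣ j ∣ ×′ 1#)
        ≈⟨ R.sym (*-cong (sign-abs i) (sign-abs j)) ⟩
      ⟦ i ⟧ℤ * ⟦ j ⟧ℤ ∎

    ⊖-homo : ∀ m n → ⟦ m ℤ.⊖ n ⟧ℤ ≈ m ×′ 1# - n ×′ 1#
    ⊖-homo zero zero = R.sym (R.trans (+-congˡ -0#≈0#) (+-identityʳ 0#))
    ⊖-homo zero (suc n) = R.sym (+-identityˡ _)
    ⊖-homo (suc m) zero = R.sym (R.trans (+-congˡ -0#≈0#) (+-identityʳ _))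
    ⊖-homo (suc m) (suc n) = begin
      ⟦ suc m ℤ.⊖ suc n ⟧ℤ                 ≡⟨ cong ⟦_⟧ℤ (ℤ.[1+m]⊖[1+n]≡m⊖n m n) ⟩
      ⟦ m ℤ.⊖ n ⟧ℤ                         ≈⟨ ⊖-homo m n ⟩
      m ×′ 1# - n ×′ 1#                    ≈⟨ R.sym (+-identityˡ _) ⟩
      0# + (m ×′ 1# - n ×′ 1#)             ≈⟨ +-congʳ (R.sym (-‿inverseʳ 1#)) ⟩
      (1# - 1#) + (m ×′ 1# - n ×′ 1#)      ≈⟨ +-assoc 1# (- 1#) _ ⟩
      1# + (- 1# + (m ×′ 1# - n ×′ 1#))    ≈⟨ +-congˡ (R.sym (+-assoc _ _ _)) ⟩
      1# + ((- 1# + m ×′ 1#) - n ×′ 1#)    ≈⟨ +-congˡ (+-congʳ (+-comm _ _)) ⟩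
      1# + ((m ×′ 1# - 1#) - n ×′ 1#)      ≈⟨ +-congˡ (+-assoc _ _ _) ⟩
      1# + (m ×′ 1# + (- 1# - n ×′ 1#))    ≈⟨ R.sym (+-assoc _ _ _) ⟩
      (1# + m ×′ 1#) + (- 1# - n ×′ 1#)    ≈⟨ +-congˡ (-‿+-comm 1# _) ⟩
      (1# + m ×′ 1#) - (1# + n ×′ 1#)      ≈⟨ R.sym (+-cong (suc× m) (-‿cong (suc× n))) ⟩
      suc m ×′ 1# - suc n ×′ 1#            ∎

    +-homo : ∀ i j → ⟦ i ℤ.+ j ⟧ℤ ≈ ⟦ i ⟧ℤ + ⟦ j ⟧ℤ
    +-homo ℤ.-[1+ m ] ℤ.-[1+ n ] = begin
      - (suc (suc (m ℕ.+ n)) ×′ 1#)   ≡⟨ cong (λ k → - (suc k ×′ 1#)) (sym (ℕ.+-suc m n)) ⟩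
      - ((suc m ℕ.+ suc n) ×′ 1#)     ≈⟨ -‿cong (×-homo-+ 1# (suc m) (suc n)) ⟩
      - (suc m ×′ 1# + suc n ×′ 1#)    ≈⟨ R.sym (-‿+-comm _ _) ⟩
      - (suc m ×′ 1#) - suc n ×′ 1#    ∎
    +-homo ℤ.-[1+ m ] (ℤ.+ n) = R.trans (⊖-homo n (suc m)) (+-comm _ _)
    +-homo (ℤ.+ m) ℤ.-[1+ n ] = ⊖-homo m (suc n)
    +-homo (ℤ.+ m) (ℤ.+ n) = ×-homo-+ 1# m n

    -‿homo : ∀ i → ⟦ ℤ.- i ⟧ℤ ≈ - ⟦ i ⟧ℤ
    -‿homo ℤ.-[1+ n ] = R.sym (-‿involutive _)
    -‿homo (ℤ.+ zero) = R.sym -0#≈0#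
    -‿homo (ℤ.+ suc n) = R.refl

    homomorphism : ℤ.+-*-rawRing ACR.-Raw-AlmostCommutative⟶ ACR.fromCommutativeRing R
    homomorphism = record
      { ⟦_⟧ = ⟦_⟧ℤ ; +-homo = +-homo ; *-homo = *-homo ; -‿homo = -‿homo
      ; 0-homo = R.refl ; 1-homo = R.refl }

  open import Algebra.Solver.Ring ℤ.+-*-rawRing (ACR.fromCommutativeRing R) homomorphism
    (λ i j → Maybe.map (λ i≡j → R.reflexive (cong ⟦_⟧ℤ i≡j)) (dec⇒maybe (i ℤ.≟ j)))
    public

module Coordinates {a ℓ} (R : RawRing a ℓ) where
  open RawRing R

  infixl 6 _-_
  _-_ : Carrier → Carrier → Carrier
  x - y = x + - y

  Vector⁴ : Set a
  Vector⁴ = Fin 4 → Carrier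

  infix 7 _·_
  _·_ : Vector⁴ → Vector⁴ → Carrier
  x · y = ((x 0F * y 0F + x 1F * y 1F) + x 2F * y 2F) + x 3F * y 3F

  det₃ : (a b c d e f g h i : Carrier) → Carrier
  det₃ a b c d e f g h i = (a * (e * i - f * h) - b * (d * i - f * g)) + c * (d * h - e * g)

  minor : (x y z : Vector⁴) (r₁ r₂ r₃ : Fin 4) → Carrier
  minor x y z r₁ r₂ r₃ = det₃ (x r₁) (y r₁) (z r₁) (x r₂) (y r₂) (z r₂) (x r₃) (y r₃) (z r₃)

  cofactor : Vector⁴ → Vector⁴ → Vector⁴ → Vector⁴
  cofactor x y z 0F = - minor x y z 1F 2F 3F
  cofactor x y z 1F = minor x y z 0F 2F 3F
  cofactor x y z 2F = - minor x y z 0F 1F 3F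
  cofactor x y z 3F = minor x y z 0F 1F 2F

  det₄ : Vector⁴ → Vector⁴ → Vector⁴ → Vector⁴ → Carrier
  det₄ x y z w = cofactor x y z · w

  unit : Fin 4 → Vector⁴
  unit 0F = 1# ∷ 0# ∷ 0# ∷ 0# ∷ []
  unit 1F = 0# ∷ 1# ∷ 0# ∷ 0# ∷ []
  unit 2F = 0# ∷ 0# ∷ 1# ∷ 0# ∷ []
  unit 3F = 0# ∷ 0# ∷ 0# ∷ 1# ∷ []

  combination : Carrier → Vector⁴ → Carrier → Vector⁴ → Vector⁴
  combination a x b y i = a * x i + b * y i

byCoordinate : ∀ {p} {P : Fin 4 → Set p} → P 0F → P 1F → P 2F → P 3F → ∀ t → P t
byCoordinate p₀ p₁ p₂ p₃ 0F = p₀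
byCoordinate p₀ p₁ p₂ p₃ 1F = p₁
byCoordinate p₀ p₁ p₂ p₃ 2F = p₂
byCoordinate p₀ p₁ p₂ p₃ 3F = p₃

module FieldProperties (F : Field) where
  open Field F public

  commutativeRing : CommutativeRing 0ℓ 0ℓ
  commutativeRing = record { isCommutativeRing = isCommutativeRing }

  open CommutativeRing commutativeRing public
    using (+-comm; *-assoc; *-comm; +-identityˡ; *-identityˡ; *-identityʳ; zeroʳ; distribˡ; ring; rawRing)
  open import Algebra.Properties.Ring ring public using (-0#≈0#; x∙y⁻¹≈ε⇒x≈y; x≈y⇒x∙y⁻¹≈ε)
  open ℤ-Solver commutativeRing public
  open Coordinates rawRing public
  open ≡-Reasoning

  :0 : ∀ {n} → Polynomial n
  :0 = con (ℤ.+ 0)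

  :1 : ∀ {n} → Polynomial n
  :1 = con (ℤ.+ 1)

  1≢0 : 1# ≢ 0#
  1≢0 1≡0 = 0≢1 (sym 1≡0)

  x≢0∧x*y≡0⇒y≡0 : ∀ {x y} → x ≢ 0# → x * y ≡ 0# → y ≡ 0#
  x≢0∧x*y≡0⇒y≡0 {x} {y} x≢0 xy≡0 = begin
    y                                  ≡⟨ solve 3 (λ x y x⁻¹ → y := x⁻¹ :* (x :* y) :+ (:1 :- x :* x⁻¹) :* y) refl x y x⁻¹ ⟩
    x⁻¹ * (x * y) + (1# - x * x⁻¹) * y ≡⟨ cong₂ (λ a b → x⁻¹ * a + (1# - b) * y) xy≡0 xx⁻¹≡1 ⟩
    x⁻¹ * 0# + (1# - 1#) * y           ≡⟨ solve 2 (λ x⁻¹ y → x⁻¹ :* :0 :+ (:1 :- :1) :* y := :0) refl x⁻¹ y ⟩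
    0#                                 ∎
    where
    x⁻¹ = proj₁ (inverse x x≢0)
    xx⁻¹≡1 = proj₂ (inverse x x≢0)

  x≢0∧y≢0⇒x*y≢0 : ∀ {x y} → x ≢ 0# → y ≢ 0# → x * y ≢ 0#
  x≢0∧y≢0⇒x*y≢0 x≢0 y≢0 xy≡0 = y≢0 (x≢0∧x*y≡0⇒y≡0 x≢0 xy≡0)

  linear-root : ∀ {a b z} (b≢0 : b ≢ 0#) → a + b * z ≡ 0# → z ≡ - a * proj₁ (inverse b b≢0)
  linear-root {a} {b} {z} b≢0 a+bz≡0 = begin
    z                                          ≡⟨ solve 4 (λ a b z b⁻¹ → z := b⁻¹ :* (a :+ b :* z) :- a :* b⁻¹ :+ (:1 :- b :* b⁻¹) :* z) refl a b z b⁻¹ ⟩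
    b⁻¹ * (a + b * z) - a * b⁻¹ + (1# - b * b⁻¹) * z ≡⟨ cong₂ (λ s t → b⁻¹ * s - a * b⁻¹ + (1# - t) * z) a+bz≡0 bb⁻¹≡1 ⟩
    b⁻¹ * 0# - a * b⁻¹ + (1# - 1#) * z           ≡⟨ solve 3 (λ a z b⁻¹ → b⁻¹ :* :0 :- a :* b⁻¹ :+ (:1 :- :1) :* z := :- a :* b⁻¹) refl a z b⁻¹ ⟩
    - a * b⁻¹                                  ∎
    where
    b⁻¹ = proj₁ (inverse b b≢0)
    bb⁻¹≡1 = proj₂ (inverse b b≢0)

  ∼-refl : ∀ x → _∼_ F x x
  ∼-refl x = 1# , 1≢0 , λ i → sym (*-identityˡ (x i))

  ∼-trans : ∀ {x y z} → _∼_ F x y → _∼_ F y z → _∼_ F x z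
  ∼-trans (c , c≢0 , x≡cy) (d , d≢0 , y≡dz) =
    c * d , x≢0∧y≢0⇒x*y≢0 c≢0 d≢0 , λ i → trans (x≡cy i) (trans (cong (c *_) (y≡dz i)) (sym (*-assoc c d _)))

  sumF-cong : ∀ {m} {f g : Fin m → Carrier} → (∀ i → f i ≡ g i) → sumF F f ≡ sumF F g
  sumF-cong {zero} f≗g = refl
  sumF-cong {suc m} f≗g = cong₂ _+_ (f≗g zero) (sumF-cong (λ i → f≗g (suc i)))

  sumF-+ : ∀ {m} (f g : Fin m → Carrier) → sumF F (λ i → f i + g i) ≡ sumF F f + sumF F g
  sumF-+ {zero} f g = sym (+-identityˡ 0#)
  sumF-+ {suc m} f g = trans (cong ((f zero + g zero) +_) (sumF-+ (λ i → f (suc i)) (λ i → g (suc i))))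
    (solve 4 (λ a b c d → (a :+ b) :+ (c :+ d) := (a :+ c) :+ (b :+ d)) refl (f zero) (g zero) _ _)

  sumF-*ˡ : ∀ {m} c (f : Fin m → Carrier) → sumF F (λ i → c * f i) ≡ c * sumF F f
  sumF-*ˡ {zero} c f = sym (zeroʳ c)
  sumF-*ˡ {suc m} c f = trans (cong ((c * f zero) +_) (sumF-*ˡ c (λ i → f (suc i)))) (sym (distribˡ c _ _))

  sumF-0 : ∀ m → sumF F {m} (λ _ → 0#) ≡ 0#
  sumF-0 zero = refl
  sumF-0 (suc m) = trans (cong (0# +_) (sumF-0 m)) (+-identityˡ 0#)

  -- one step of Gaussian elimination with pivot row p: a solution y of the eliminated rows
  -- p₀ aₖ₊₁ − a₀ pₖ₊₁ extends to the solution back-substitute p y of the rows a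
  back-substitute : ∀ {n} → (Fin (suc n) → Carrier) → (Fin n → Carrier) → Fin (suc n) → Carrier
  back-substitute p y zero = - sumF F (λ k → p (suc k) * y k)
  back-substitute p y (suc k) = p zero * y k

  back-substitute-row : ∀ {n} (p a : Fin (suc n) → Carrier) y →
    sumF F (λ j → a j * back-substitute p y j) ≡ sumF F (λ k → (p zero * a (suc k) - a zero * p (suc k)) * y k)
  back-substitute-row p a y = sym (begin
    sumF F (λ k → (p zero * a (suc k) - a zero * p (suc k)) * y k)
      ≡⟨ sumF-cong (λ k → solve 5 (λ p₀ a a₀ p y → (p₀ :* a :- a₀ :* p) :* y := a :* (p₀ :* y) :+ (:- a₀) :* (p :* y))
                            refl (p zero) (a (suc k)) (a zero) (p (suc k)) (y k)) ⟩
    sumF F (λ k → a (suc k) * x (suc k) + (- a zero) * (p (suc k) * y k))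
      ≡⟨ sumF-+ (λ k → a (suc k) * x (suc k)) (λ k → (- a zero) * (p (suc k) * y k)) ⟩
    sumF F (λ k → a (suc k) * x (suc k)) + sumF F (λ k → (- a zero) * (p (suc k) * y k))
      ≡⟨ cong (sumF F (λ k → a (suc k) * x (suc k)) +_) (sumF-*ˡ (- a zero) (λ k → p (suc k) * y k)) ⟩
    sumF F (λ k → a (suc k) * x (suc k)) + (- a zero) * sumF F (λ k → p (suc k) * y k)
      ≡⟨ solve 3 (λ s a₀ t → s :+ (:- a₀) :* t := a₀ :* (:- t) :+ s)
           refl (sumF F (λ k → a (suc k) * x (suc k))) (a zero) (sumF F (λ k → p (suc k) * y k)) ⟩
    a zero * x zero + sumF F (λ k → a (suc k) * x (suc k)) ∎)
    where
    x = back-substitute p y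

  -- The formulas of Coordinates instantiated with polynomials: identities between them are proved by
  -- the ring solver, and evaluate definitionally to the same formulas in F.
  polynomialRing : ℕ → RawRing 0ℓ 0ℓ
  polynomialRing n = record
    { Carrier = Polynomial n ; _≈_ = _≡_ ; _+_ = _:+_ ; _*_ = _:*_ ; -_ = :-_ ; 0# = :0 ; 1# = :1 }

  module Poly {n} = Coordinates (polynomialRing n)

  module Variables (k s : ℕ) where
    vector : Fin k → Fin 4 → Polynomial (k ℕ.* 4 ℕ.+ s)
    vector j i = var (combine j i ↑ˡ s)

    scalar : Fin s → Polynomial (k ℕ.* 4 ℕ.+ s)
    scalar m = var ((k ℕ.* 4) ↑ʳ m)

    environment : (Fin k → V4 F) → (Fin s → Carrier) → Vec.Vec Carrier (k ℕ.* 4 ℕ.+ s)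
    environment vs xs = Vec.concat (Vec.tabulate (λ j → Vec.tabulate (vs j))) Vec.++ Vec.tabulate xs

  ·-congˡ : ∀ {x x′} w → (∀ i → x i ≡ x′ i) → x · w ≡ x′ · w
  ·-congˡ w x≗x′ = cong₂ _+_ (cong₂ _+_ (cong₂ _+_ (term 0F) (term 1F)) (term 2F)) (term 3F)
    where
    term : ∀ i → _ * w i ≡ _ * w i
    term i = cong (_* w i) (x≗x′ i)

  ·-congʳ : ∀ x {w w′} → (∀ i → w i ≡ w′ i) → x · w ≡ x · w′
  ·-congʳ x w≗w′ = cong₂ _+_ (cong₂ _+_ (cong₂ _+_ (term 0F) (term 1F)) (term 2F)) (term 3F)
    where
    term : ∀ i → x i * _ ≡ x i * _
    term i = cong (x i *_) (w≗w′ i)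

  ·-zeroʳ : ∀ x {w} → (∀ i → w i ≡ 0#) → x · w ≡ 0#
  ·-zeroʳ x w≡0 = trans (·-congʳ x w≡0)
    (solve 4 (λ x₀ x₁ x₂ x₃ → (x₀ ∷ x₁ ∷ x₂ ∷ x₃ ∷ []) Poly.· (λ _ → :0) := :0) refl (x 0F) (x 1F) (x 2F) (x 3F))

  ·-unitʳ : ∀ x i → x · unit i ≡ x i
  ·-unitʳ x = byCoordinate (prove ρ (x′ Poly.· Poly.unit 0F) (x′ 0F) refl) (prove ρ (x′ Poly.· Poly.unit 1F) (x′ 1F) refl)
                           (prove ρ (x′ Poly.· Poly.unit 2F) (x′ 2F) refl) (prove ρ (x′ Poly.· Poly.unit 3F) (x′ 3F) refl)
    where
    open Variables 1 0
    ρ = environment (x ∷ []) []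
    x′ = vector 0F

  ·-scaleˡ : ∀ μ x w → (λ i → μ * x i) · w ≡ μ * (x · w)
  ·-scaleˡ μ x w = prove (environment (x ∷ w ∷ []) (μ ∷ []))
    ((λ i → scalar 0F :* vector 0F i) Poly.· vector 1F) (scalar 0F :* (vector 0F Poly.· vector 1F)) refl
    where open Variables 2 1

  det₃-cong : ∀ {a a′ b b′ c c′ d d′ e e′ f f′ g g′ h h′ i i′} →
    a ≡ a′ → b ≡ b′ → c ≡ c′ → d ≡ d′ → e ≡ e′ → f ≡ f′ → g ≡ g′ → h ≡ h′ → i ≡ i′ →
    det₃ a b c d e f g h i ≡ det₃ a′ b′ c′ d′ e′ f′ g′ h′ i′
  det₃-cong refl refl refl refl refl refl refl refl refl = refl

  det₃-rank≤2 : ∀ (a a′ w w′ : Fin 3 → Carrier) → let M = λ i j → w i * a j + w′ i * a′ j in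
    det₃ (M 0F 0F) (M 0F 1F) (M 0F 2F) (M 1F 0F) (M 1F 1F) (M 1F 2F) (M 2F 0F) (M 2F 1F) (M 2F 2F) ≡ 0#
  det₃-rank≤2 a a′ w w′ = solve 12 (λ a₀ a₁ a₂ a′₀ a′₁ a′₂ w₀ w₁ w₂ w′₀ w′₁ w′₂ →
    let M = λ (i j : Fin 3) → (w₀ ∷ w₁ ∷ w₂ ∷ []) i :* (a₀ ∷ a₁ ∷ a₂ ∷ []) j :+ (w′₀ ∷ w′₁ ∷ w′₂ ∷ []) i :* (a′₀ ∷ a′₁ ∷ a′₂ ∷ []) j
    in Poly.det₃ (M 0F 0F) (M 0F 1F) (M 0F 2F) (M 1F 0F) (M 1F 1F) (M 1F 2F) (M 2F 0F) (M 2F 1F) (M 2F 2F) := :0)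
    refl (a 0F) (a 1F) (a 2F) (a′ 0F) (a′ 1F) (a′ 2F) (w 0F) (w 1F) (w 2F) (w′ 0F) (w′ 1F) (w′ 2F)

  laplace : ∀ (x y z v w : V4 F) t →
    det₄ x y z w * v t ≡ ((det₄ x y z v * w t + det₄ v y z w * x t) + det₄ x v z w * y t) + det₄ x y v w * z t
  laplace x y z v w = byCoordinate
    (prove ρ (L 0F) (R 0F) refl) (prove ρ (L 1F) (R 1F) refl) (prove ρ (L 2F) (R 2F) refl) (prove ρ (L 3F) (R 3F) refl)
    where
    open Variables 5 0
    ρ = environment (x ∷ y ∷ z ∷ v ∷ w ∷ []) []
    x′ = vector 0F
    y′ = vector 1F
    z′ = vector 2F
    v′ = vector 3F
    w′ = vector 4F
    L R : Fin 4 → Polynomial 20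
    L t = Poly.det₄ x′ y′ z′ w′ :* v′ t
    R t = ((Poly.det₄ x′ y′ z′ v′ :* w′ t :+ Poly.det₄ v′ y′ z′ w′ :* x′ t) :+ Poly.det₄ x′ v′ z′ w′ :* y′ t)
          :+ Poly.det₄ x′ y′ v′ w′ :* z′ t

  det₄-rotate : ∀ x y z w → det₄ x y z w ≡ - det₄ w x y z
  det₄-rotate x y z w = prove (environment (x ∷ y ∷ z ∷ w ∷ []) [])
    (Poly.det₄ (vector 0F) (vector 1F) (vector 2F) (vector 3F)) (:- Poly.det₄ (vector 3F) (vector 0F) (vector 1F) (vector 2F)) refl
    where open Variables 4 0

  det₄-swap : ∀ x y z w → det₄ x y z w ≡ det₄ z w x y
  det₄-swap x y z w = prove (environment (x ∷ y ∷ z ∷ w ∷ []) [])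
    (Poly.det₄ (vector 0F) (vector 1F) (vector 2F) (vector 3F)) (Poly.det₄ (vector 2F) (vector 3F) (vector 0F) (vector 1F)) refl
    where open Variables 4 0

  det₄-zero₄ : ∀ x y z {w} → (∀ i → w i ≡ 0#) → det₄ x y z w ≡ 0#
  det₄-zero₄ x y z = ·-zeroʳ (cofactor x y z)

  det₄-zero₃ : ∀ x y {z} w → (∀ i → z i ≡ 0#) → det₄ x y z w ≡ 0#
  det₄-zero₃ x y {z} w z≡0 = trans (det₄-rotate x y z w) (trans (cong -_ (det₄-zero₄ w x y z≡0)) -0#≈0#)

  det₄-zero₂ : ∀ x {y} z w → (∀ i → y i ≡ 0#) → det₄ x y z w ≡ 0#
  det₄-zero₂ x {y} z w y≡0 = trans (det₄-rotate x y z w) (trans (cong -_ (det₄-zero₃ w x z y≡0)) -0#≈0#)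

  det₄-zero₁ : ∀ {x} y z w → (∀ i → x i ≡ 0#) → det₄ x y z w ≡ 0#
  det₄-zero₁ {x} y z w x≡0 = trans (det₄-rotate x y z w) (trans (cong -_ (det₄-zero₂ w y z x≡0)) -0#≈0#)

  module _ {x y z : V4 F} (cofactor≢0 : NonZero F (cofactor x y z)) where

    private
      vanishing : (∀ w → det₄ x y z w ≡ 0#) → ⊥
      vanishing det≡0 = cofactor≢0 λ t → trans (sym (·-unitʳ (cofactor x y z) t)) (det≡0 (unit t))

    cofactor≢0⇒nonzero₁ : NonZero F x
    cofactor≢0⇒nonzero₁ x≡0 = vanishing λ w → det₄-zero₁ y z w x≡0

    cofactor≢0⇒nonzero₂ : NonZero F y
    cofactor≢0⇒nonzero₂ y≡0 = vanishing λ w → det₄-zero₂ x z w y≡0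

    cofactor≢0⇒nonzero₃ : NonZero F z
    cofactor≢0⇒nonzero₃ z≡0 = vanishing λ w → det₄-zero₃ x y w z≡0

    -- Laplace's identity with the unit vector e for which D = det₄ x y z e ≠ 0 solves for w.
    cramer : DecidableEquality Carrier → ∀ {w} → det₄ x y z w ≡ 0# → InSpan F w (x ∷ y ∷ z ∷ [])
    cramer _≟_ {w} det≡0 with ¬∀⟶∃¬ 4 _ (λ i → cofactor x y z i ≟ 0#) cofactor≢0
    ... | i , cofactorᵢ≢0 = coefficient , λ t → begin
      w t
        ≡⟨ solve 3 (λ D D⁻¹ w → w := D⁻¹ :* (D :* w) :+ (:1 :- D :* D⁻¹) :* w) refl D D⁻¹ (w t) ⟩
      D⁻¹ * (D * w t) + (1# - D * D⁻¹) * w t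
        ≡⟨ cong₂ (λ a b → D⁻¹ * a + (1# - b) * w t) (laplace x y z w e t) DD⁻¹≡1 ⟩
      D⁻¹ * (((det₄ x y z w * e t + det₄ w y z e * x t) + det₄ x w z e * y t) + det₄ x y w e * z t) + (1# - 1#) * w t
        ≡⟨ cong (λ d → D⁻¹ * (((d * e t + det₄ w y z e * x t) + det₄ x w z e * y t) + det₄ x y w e * z t) + (1# - 1#) * w t) det≡0 ⟩
      D⁻¹ * (((0# * e t + det₄ w y z e * x t) + det₄ x w z e * y t) + det₄ x y w e * z t) + (1# - 1#) * w t
        ≡⟨ solve 9 (λ D⁻¹ e w a b c x y z →
             D⁻¹ :* (((:0 :* e :+ a :* x) :+ b :* y) :+ c :* z) :+ (:1 :- :1) :* w
             := D⁻¹ :* a :* x :+ (D⁻¹ :* b :* y :+ (D⁻¹ :* c :* z :+ :0)))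
           refl D⁻¹ (e t) (w t) (det₄ w y z e) (det₄ x w z e) (det₄ x y w e) (x t) (y t) (z t) ⟩
      coefficient 0F * x t + (coefficient 1F * y t + (coefficient 2F * z t + 0#)) ∎
      where
      e = unit i
      D = det₄ x y z e
      D≢0 : D ≢ 0#
      D≢0 D≡0 = cofactorᵢ≢0 (trans (sym (·-unitʳ (cofactor x y z) i)) D≡0)
      D⁻¹ = proj₁ (inverse D D≢0)
      DD⁻¹≡1 = proj₂ (inverse D D≢0)
      coefficient : Fin 3 → Carrier
      coefficient 0F = D⁻¹ * det₄ w y z e
      coefficient 1F = D⁻¹ * det₄ x w z e
      coefficient 2F = D⁻¹ * det₄ x y w e

  -- The difference of the two combinations vanishes, and pairing it with the cofactors of
  -- u v v′ and u v u′ isolates γ and δ.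
  det₄≢0⇒independent : ∀ {u v u′ v′} → det₄ u v u′ v′ ≢ 0# → ∀ α β γ δ →
    (∀ i → combination α u β v i ≡ combination γ u′ δ v′ i) → γ ≡ 0# × δ ≡ 0#
  det₄≢0⇒independent {u} {v} {u′} {v′} D≢0 α β γ δ same =
    x≢0∧x*y≡0⇒y≡0 D≢0 (trans Dγ≡ (·-zeroʳ (cofactor u v v′) difference≡0)) ,
    x≢0∧x*y≡0⇒y≡0 D≢0 (trans Dδ≡ (trans (cong -_ (·-zeroʳ (cofactor u v u′) difference≡0)) -0#≈0#))
    where
    difference : V4 F
    difference i = combination α u β v i - combination γ u′ δ v′ i
    difference≡0 : ∀ i → difference i ≡ 0#
    difference≡0 i = x≈y⇒x∙y⁻¹≈ε (same i)
    open Variables 4 4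
    ρ = environment (u ∷ v ∷ u′ ∷ v′ ∷ []) (α ∷ β ∷ γ ∷ δ ∷ [])
    D′ : Polynomial 20
    D′ = Poly.det₄ (vector 0F) (vector 1F) (vector 2F) (vector 3F)
    difference′ : Fin 4 → Polynomial 20
    difference′ i = (scalar 0F :* vector 0F i :+ scalar 1F :* vector 1F i) :- (scalar 2F :* vector 2F i :+ scalar 3F :* vector 3F i)
    Dγ≡ : det₄ u v u′ v′ * γ ≡ cofactor u v v′ · difference
    Dγ≡ = prove ρ (D′ :* scalar 2F) (Poly.cofactor (vector 0F) (vector 1F) (vector 3F) Poly.· difference′) refl
    Dδ≡ : det₄ u v u′ v′ * δ ≡ - (cofactor u v u′ · difference)
    Dδ≡ = prove ρ (D′ :* scalar 3F) (:- (Poly.cofactor (vector 0F) (vector 1F) (vector 2F) Poly.· difference′)) refl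

module SubfieldProperties (F : Field) (K : Subfield F) where
  open FieldProperties F
  open Subfield K public
  open ≡-Reasoning

  In-− : ∀ {x y} → In x → In y → In (x - y)
  In-− x∈K y∈K = In-+ x∈K (In-- y∈K)

  In-sumF : ∀ {m} (f : Fin m → Carrier) → (∀ i → In (f i)) → In (sumF F f)
  In-sumF {zero} f f∈K = In-0
  In-sumF {suc m} f f∈K = In-+ (f∈K zero) (In-sumF (λ i → f (suc i)) (λ i → f∈K (suc i)))

  ·-In : ∀ {x y} → (∀ i → In (x i)) → (∀ i → In (y i)) → In (x · y)
  ·-In {x} {y} x∈K y∈K = In-+ (In-+ (In-+ (term 0F) (term 1F)) (term 2F)) (term 3F)
    where
    term : ∀ i → In (x i * y i)
    term i = In-* (x∈K i) (y∈K i)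

  nontrivial-kernel : DecidableEquality Carrier → ∀ m n → m ℕ.< n →
    (A : Fin m → Fin n → Carrier) → (∀ l j → In (A l j)) →
    Σ (Fin n → Carrier) λ x → (∀ j → In (x j)) × ¬ (∀ j → x j ≡ 0#) × (∀ l → sumF F (λ j → A l j * x j) ≡ 0#)
  nontrivial-kernel _≟_ m (suc n) m<n A A∈K with all? (λ l → A l zero ≟ 0#)
  ... | yes column₀≡0 = e₀ , e₀∈K , (λ e₀≡0 → 1≢0 (e₀≡0 zero)) , λ l → begin
    A l zero * 1# + sumF F (λ j → A l (suc j) * 0#)
      ≡⟨ cong₂ (λ a s → a * 1# + s) (column₀≡0 l) (trans (sumF-cong (λ j → zeroʳ (A l (suc j)))) (sumF-0 n)) ⟩
    0# * 1# + 0#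
      ≡⟨ solve 0 (:0 :* :1 :+ :0 := :0) refl ⟩
    0# ∎
    where
    e₀ : Fin (suc n) → Carrier
    e₀ zero = 1#
    e₀ (suc _) = 0#
    e₀∈K : ∀ j → In (e₀ j)
    e₀∈K zero = In-1
    e₀∈K (suc j) = In-0
  ... | no column₀≢0 with ¬∀⟶∃¬ m _ (λ l → A l zero ≟ 0#) column₀≢0
  nontrivial-kernel _≟_ (suc m) (suc n) (s≤s m<n) A A∈K | no _ | l₀ , pivot≢0 =
    back-substitute (A l₀) y , x∈K , x≢0 , solves
    where
    B : Fin (suc m) → Fin n → Carrier
    B l k = A l₀ zero * A l (suc k) - A l zero * A l₀ (suc k)
    B∈K : ∀ l k → In (B l k)
    B∈K l k = In-− (In-* (A∈K l₀ zero) (A∈K l (suc k))) (In-* (A∈K l zero) (A∈K l₀ (suc k)))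
    reduced = nontrivial-kernel _≟_ m n m<n (λ l → B (punchIn l₀ l)) (λ l → B∈K (punchIn l₀ l))
    y = proj₁ reduced
    y∈K = proj₁ (proj₂ reduced)
    y≢0 = proj₁ (proj₂ (proj₂ reduced))
    y-solves = proj₂ (proj₂ (proj₂ reduced))
    x∈K : ∀ j → In (back-substitute (A l₀) y j)
    x∈K zero = In-- (In-sumF _ (λ k → In-* (A∈K l₀ (suc k)) (y∈K k)))
    x∈K (suc k) = In-* (A∈K l₀ zero) (y∈K k)
    x≢0 : ¬ (∀ j → back-substitute (A l₀) y j ≡ 0#)
    x≢0 x≡0 = y≢0 (λ k → x≢0∧x*y≡0⇒y≡0 pivot≢0 (x≡0 (suc k)))
    solves : ∀ l → sumF F (λ j → A l j * back-substitute (A l₀) y j) ≡ 0#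
    solves l with l Fin.≟ l₀
    ... | yes refl = trans (back-substitute-row (A l₀) (A l₀) y) (trans (sumF-cong (λ k →
            solve 3 (λ p b y → (p :* b :- p :* b) :* y := :0) refl (A l₀ zero) (A l₀ (suc k)) (y k))) (sumF-0 n))
    ... | no l≢l₀ = trans (back-substitute-row (A l₀) (A l) y) (trans
            (cong (λ l′ → sumF F (λ k → B l′ k * y k)) (sym (punchIn-punchOut (λ l₀≡l → l≢l₀ (sym l₀≡l)))))
            (y-solves (punchOut (λ l₀≡l → l≢l₀ (sym l₀≡l)))))

  OnLine-resp-∼ : ∀ {l x y} → _∼_ F x y → NonZero F x → OnLine F K l y → OnLine F K l x
  OnLine-resp-∼ x∼y x≢0 (_ , a , b , a∈K , b∈K , y∼ab) = x≢0 , a , b , a∈K , b∈K , ∼-trans x∼y y∼ab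

  OnLine⇒combination : ∀ l {x} → OnLine F K l x →
    Σ Carrier λ α → Σ Carrier λ β → ∀ i → x i ≡ combination α (SubLine.u l) β (SubLine.v l) i
  OnLine⇒combination l (_ , a , b , _ , _ , c , _ , x≡c[au+bv]) = c * a , c * b , λ i →
    trans (x≡c[au+bv] i)
      (solve 5 (λ c a b u v → c :* (a :* u :+ b :* v) := (c :* a) :* u :+ (c :* b) :* v) refl c a b (SubLine.u l i) (SubLine.v l i))

  det₄≢0⇒skew : ∀ l m → det₄ (SubLine.u l) (SubLine.v l) (SubLine.u m) (SubLine.v m) ≢ 0# → Skew F K l m
  det₄≢0⇒skew l m D≢0 x x∈l x∈m =
    let α , β , x≡αu+βv = OnLine⇒combination l x∈l
        γ , δ , x≡γu′+δv′ = OnLine⇒combination m x∈m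
        γ≡0 , δ≡0 = det₄≢0⇒independent {SubLine.u l} {SubLine.v l} {SubLine.u m} {SubLine.v m}
                      D≢0 α β γ δ (λ i → trans (sym (x≡αu+βv i)) (x≡γu′+δv′ i))
    in proj₁ x∈l λ i → begin
      x i                                     ≡⟨ x≡γu′+δv′ i ⟩
      γ * SubLine.u m i + δ * SubLine.v m i   ≡⟨ cong₂ (λ a b → a * SubLine.u m i + b * SubLine.v m i) γ≡0 δ≡0 ⟩
      0# * SubLine.u m i + 0# * SubLine.v m i ≡⟨ solve 2 (λ u v → :0 :* u :+ :0 :* v := :0) refl (SubLine.u m i) (SubLine.v m i) ⟩
      0#                                      ∎

  record EchelonLine : Set where
    field
      u v : V4 F
      u∈K : ∀ i → In (u i)
      v∈K : ∀ i → In (v i)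
      π₁ π₂ : Fin 4
      u-π₁ : u π₁ ≡ 1#
      v-π₁ : v π₁ ≡ 0#
      u-π₂ : u π₂ ≡ 0#
      v-π₂ : v π₂ ≡ 1#

    combination-π₁ : ∀ a b → combination a u b v π₁ ≡ a
    combination-π₁ a b = trans (cong₂ (λ s t → a * s + b * t) u-π₁ v-π₁) (solve 2 (λ a b → a :* :1 :+ b :* :0 := a) refl a b)

    combination-π₂ : ∀ a b → combination a u b v π₂ ≡ b
    combination-π₂ a b = trans (cong₂ (λ s t → a * s + b * t) u-π₂ v-π₂) (solve 2 (λ a b → a :* :0 :+ b :* :1 := b) refl a b)

    subLine : SubLine F K
    subLine = record { u = u ; v = v ; u-In = u∈K ; v-In = v∈K
                     ; indep = λ a b _ _ ab≡0 → trans (sym (combination-π₁ a b)) (ab≡0 π₁) ,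
                                                trans (sym (combination-π₂ a b)) (ab≡0 π₂) }

module Counting where

  Fin-size : ∀ n → HasSize (Fin n) n
  Fin-size n = (λ i → i) , (λ i j i≡j → i≡j) , (λ i → i , refl)

  ×-size : ∀ {A B m n} → HasSize A m → HasSize B n → HasSize (A × B) (m ℕ.* n)
  ×-size {A} {B} {m} {n} (eA , eA-inj , eA-surj) (eB , eB-inj , eB-surj) = e , e-inj , e-surj
    where
    e : Fin (m ℕ.* n) → A × B
    e k = eA (proj₁ (remQuot {m} n k)) , eB (proj₂ (remQuot {m} n k))
    e-inj : ∀ k l → e k ≡ e l → k ≡ l
    e-inj k l ek≡el = trans (sym (combine-remQuot {m} n k))
      (trans (cong₂ combine (eA-inj _ _ (cong proj₁ ek≡el)) (eB-inj _ _ (cong proj₂ ek≡el))) (combine-remQuot {m} n l))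
    e-surj : ∀ ab → Σ (Fin (m ℕ.* n)) λ k → e k ≡ ab
    e-surj (a , b) with eA-surj a | eB-surj b
    ... | i , eAi≡a | j , eBj≡b =
      combine i j , trans (cong (λ ij → eA (proj₁ ij) , eB (proj₂ ij)) (remQuot-combine {m} i j)) (cong₂ _,_ eAi≡a eBj≡b)

  private
    index : ∀ {A n} → HasSize A n → A → Fin n
    index (_ , _ , e-surj) x = proj₁ (e-surj x)

    e∘index : ∀ {A n} (size : HasSize A n) x → proj₁ size (index size x) ≡ x
    e∘index (_ , _ , e-surj) x = proj₂ (e-surj x)

    index-injective : ∀ {A n} (size : HasSize A n) {x y} → index size x ≡ index size y → x ≡ y
    index-injective size {x} {y} eq = trans (sym (e∘index size x)) (trans (cong (proj₁ size) eq) (e∘index size y))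

  size⇒≟ : ∀ {A n} → HasSize A n → DecidableEquality A
  size⇒≟ size x y with index size x Fin.≟ index size y
  ... | yes i≡j = yes (index-injective size i≡j)
  ... | no i≢j = no (λ x≡y → i≢j (cong (index size) x≡y))

  module _ {A B : Set} {m n} (sizeA : HasSize A m) (sizeB : HasSize B n) where

    injective⇒size≤ : (f : A → B) → (∀ x y → f x ≡ f y → x ≡ y) → m ℕ.≤ n
    injective⇒size≤ f f-inj = injective⇒≤ {f = λ i → index sizeB (f (proj₁ sizeA i))} λ {i} {j} eq →
      proj₁ (proj₂ sizeA) i j (f-inj _ _ (index-injective sizeB eq))

    surjective⊎missing : DecidableEquality B → (f : A → B) → (∀ y → Σ A λ x → f x ≡ y) ⊎ (Σ B λ y → ∀ x → f x ≢ y)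
    surjective⊎missing _≟_ f with all? (λ k → any? (λ i → f (proj₁ sizeA i) ≟ proj₁ sizeB k))
    ... | yes all-hit = inj₁ λ y →
      let i , eq = all-hit (index sizeB y) in proj₁ sizeA i , trans eq (e∘index sizeB y)
    ... | no ¬all-hit with ¬∀⟶∃¬ n _ (λ k → any? (λ i → f (proj₁ sizeA i) ≟ proj₁ sizeB k)) ¬all-hit
    ...   | k , missed = inj₂ (proj₁ sizeB k , λ x fx≡ →
      missed (index sizeA x , trans (cong f (e∘index sizeA x)) fx≡))

  surjective⇒size≥ : ∀ {A B : Set} {m n} (sizeA : HasSize A m) (sizeB : HasSize B n) (f : A → B) →
    (∀ y → Σ A λ x → f x ≡ y) → n ℕ.≤ m
  surjective⇒size≥ sizeA sizeB f f-surj = injective⇒size≤ sizeB sizeA (λ y → proj₁ (f-surj y)) λ y y′ eq →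
    trans (sym (proj₂ (f-surj y))) (trans (cong f eq) (proj₂ (f-surj y′)))

  -- On Fin n an injection misses no value: otherwise punching the value out would inject Fin n into Fin (n - 1).
  Fin-injective⇒surjective : ∀ {n} (f : Fin n → Fin n) → (∀ i j → f i ≡ f j → i ≡ j) → ∀ k → Σ (Fin n) λ i → f i ≡ k
  Fin-injective⇒surjective {suc n} f f-inj k with any? (λ i → f i Fin.≟ k)
  ... | yes hit = hit
  ... | no miss = ⊥-elim (ℕ.<-irrefl refl (injective⇒≤ {f = λ i → punchOut (k≢f i)} λ {i} {j} eq →
          f-inj i j (punchOut-injective (k≢f i) (k≢f j) eq)))
    where
    k≢f : ∀ i → k ≢ f i
    k≢f i k≡fi = miss (i , sym k≡fi)

  injective⇒surjective : ∀ {A B : Set} {n} (sizeA : HasSize A n) (sizeB : HasSize B n) (f : A → B) →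
    (∀ x y → f x ≡ f y → x ≡ y) → ∀ y → Σ A λ x → f x ≡ y
  injective⇒surjective sizeA sizeB f f-inj y =
    let i , eq = Fin-injective⇒surjective (λ i → index sizeB (f (proj₁ sizeA i))) g-inj (index sizeB y)
    in proj₁ sizeA i , index-injective sizeB eq
    where
    g-inj : ∀ i j → index sizeB (f (proj₁ sizeA i)) ≡ index sizeB (f (proj₁ sizeA j)) → i ≡ j
    g-inj i j eq = proj₁ (proj₂ sizeA) i j (f-inj _ _ (index-injective sizeB eq))

  -- A section of f is injective, hence surjective, hence a two-sided inverse of f.
  surjective⇒injective : ∀ {A B : Set} {n} (sizeA : HasSize A n) (sizeB : HasSize B n) (f : A → B) →
    (∀ y → Σ A λ x → f x ≡ y) → ∀ x y → f x ≡ f y → x ≡ y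
  surjective⇒injective {A} {B} sizeA sizeB f f-surj x y fx≡fy = trans (sym (s∘f x)) (trans (cong s fx≡fy) (s∘f y))
    where
    s : B → A
    s b = proj₁ (f-surj b)
    f∘s : ∀ b → f (s b) ≡ b
    f∘s b = proj₂ (f-surj b)
    s∘f : ∀ a → s (f a) ≡ a
    s∘f a with injective⇒surjective sizeB sizeA s (λ b b′ eq → trans (sym (f∘s b)) (trans (cong f eq) (f∘s b′))) a
    ... | b , sb≡a = trans (cong (λ a′ → s (f a′)) (sym sb≡a)) (trans (cong s (f∘s b)) sb≡a)

module FiniteField (q′ : ℕ) (1<q′ : 1 ℕ.< q′) (F : Field) (K : Subfield F)
                   (sizeF : HasSize (Field.Carrier F) (q′ ^ 3)) (sizeK : SubHasSize F K q′) where
  open FieldProperties F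
  open SubfieldProperties F K
  open Counting
  open ≡-Reasoning

  _≟_ : DecidableEquality Carrier
  _≟_ = size⇒≟ sizeF

  κ : Fin q′ → Carrier
  κ = proj₁ sizeK

  κ∈K : ∀ i → In (κ i)
  κ∈K = proj₁ (proj₂ sizeK)

  κ-injective : ∀ i j → κ i ≡ κ j → i ≡ j
  κ-injective = proj₁ (proj₂ (proj₂ sizeK))

  index : ∀ {x} → In x → Fin q′
  index {x} x∈K = proj₁ (proj₂ (proj₂ (proj₂ sizeK)) x x∈K)

  κ∘index : ∀ {x} (x∈K : In x) → κ (index x∈K) ≡ x
  κ∘index {x} x∈K = proj₂ (proj₂ (proj₂ (proj₂ sizeK)) x x∈K)

  q′<q′^3 : q′ ℕ.< q′ ^ 3
  q′<q′^3 = subst (ℕ._< q′ ^ 3) (ℕ.*-identityʳ q′) (ℕ.^-monoʳ-< q′ 1<q′ {1} {3} (s≤s (s≤s z≤n)))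

  q′²<q′^3 : q′ ℕ.* q′ ℕ.< q′ ^ 3
  q′²<q′^3 = subst (ℕ._< q′ ^ 3) (cong (q′ ℕ.*_) (ℕ.*-identityʳ q′)) (ℕ.^-monoʳ-< q′ 1<q′ {2} {3} (s≤s (s≤s (s≤s z≤n))))

  missing : ∀ {A : Set} {m} → HasSize A m → m ℕ.< q′ ^ 3 → (f : A → Carrier) → Σ Carrier λ y → ∀ x → f x ≢ y
  missing sizeA m<q′³ f with surjective⊎missing sizeA sizeF _≟_ f
  ... | inj₁ f-surj = ⊥-elim (ℕ.<⇒≱ m<q′³ (surjective⇒size≥ sizeA sizeF f f-surj))
  ... | inj₂ y-missing = y-missing

  β : Carrier
  β = proj₁ (missing (Fin-size q′) q′<q′^3 κ)

  β∉K : ¬ In β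
  β∉K β∈K = proj₂ (missing (Fin-size q′) q′<q′^3 κ) (index β∈K) (κ∘index β∈K)

  sizeK² : HasSize (Fin q′ × Fin q′) (q′ ℕ.* q′)
  sizeK² = ×-size (Fin-size q′) (Fin-size q′)

  γ : Carrier
  γ = proj₁ (missing sizeK² q′²<q′^3 λ (i , j) → κ i + κ j * β)

  γ∉K+Kβ : ∀ {a b} → In a → In b → a + b * β ≢ γ
  γ∉K+Kβ a∈K b∈K a+bβ≡γ = proj₂ (missing sizeK² q′²<q′^3 λ (i , j) → κ i + κ j * β)
    (index a∈K , index b∈K) (trans (cong₂ (λ a b → a + b * β) (κ∘index a∈K) (κ∘index b∈K)) a+bβ≡γ)

  ⟪_⟫ : (Fin 3 → Carrier) → Carrier
  ⟪ k ⟫ = (k 0F + k 1F * β) + k 2F * γ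

  ⟪⟫-independent : ∀ {k} → (∀ j → In (k j)) → ⟪ k ⟫ ≡ 0# → ∀ j → k j ≡ 0#
  ⟪⟫-independent {k} k∈K ⟪k⟫≡0 with k 2F ≟ 0# | k 1F ≟ 0#
  ... | no k₂≢0 | _ = ⊥-elim (γ∉K+Kβ (In-* (In-- (k∈K 0F)) k₂⁻¹∈K) (In-* (In-- (k∈K 1F)) k₂⁻¹∈K) (sym (begin
    γ                                ≡⟨ linear-root k₂≢0 ⟪k⟫≡0 ⟩
    - (k 0F + k 1F * β) * k₂⁻¹       ≡⟨ solve 4 (λ k₀ k₁ β k₂⁻¹ → :- (k₀ :+ k₁ :* β) :* k₂⁻¹ := :- k₀ :* k₂⁻¹ :+ :- k₁ :* k₂⁻¹ :* β)
                                          refl (k 0F) (k 1F) β k₂⁻¹ ⟩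
    - k 0F * k₂⁻¹ + - k 1F * k₂⁻¹ * β ∎)))
    where
    k₂⁻¹ = proj₁ (inverse (k 2F) k₂≢0)
    k₂⁻¹∈K = In-⁻¹ (k∈K 2F) (proj₂ (inverse (k 2F) k₂≢0))
  ... | yes k₂≡0 | no k₁≢0 = ⊥-elim (β∉K (subst In (sym (linear-root k₁≢0 k₀+k₁β≡0))
                                (In-* (In-- (k∈K 0F)) (In-⁻¹ (k∈K 1F) (proj₂ (inverse (k 1F) k₁≢0))))))
    where
    k₀+k₁β≡0 : k 0F + k 1F * β ≡ 0#
    k₀+k₁β≡0 = begin
      k 0F + k 1F * β                   ≡⟨ solve 3 (λ a k₂ γ → a := a :+ k₂ :* γ :- k₂ :* γ) refl (k 0F + k 1F * β) (k 2F) γ ⟩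
      ⟪ k ⟫ - k 2F * γ                  ≡⟨ cong₂ (λ s t → s - t * γ) ⟪k⟫≡0 k₂≡0 ⟩
      0# - 0# * γ                       ≡⟨ solve 1 (λ γ → :0 :- :0 :* γ := :0) refl γ ⟩
      0#                                ∎
  ... | yes k₂≡0 | yes k₁≡0 = λ where
      0F → begin
        k 0F                            ≡⟨ solve 5 (λ k₀ k₁ k₂ β γ → k₀ := ((k₀ :+ k₁ :* β) :+ k₂ :* γ) :- k₁ :* β :- k₂ :* γ)
                                             refl (k 0F) (k 1F) (k 2F) β γ ⟩
        ⟪ k ⟫ - k 1F * β - k 2F * γ     ≡⟨ cong₂ (λ s t → s - t * β - k 2F * γ) ⟪k⟫≡0 k₁≡0 ⟩
        0# - 0# * β - k 2F * γ          ≡⟨ cong (λ t → 0# - 0# * β - t * γ) k₂≡0 ⟩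
        0# - 0# * β - 0# * γ            ≡⟨ solve 2 (λ β γ → :0 :- :0 :* β :- :0 :* γ := :0) refl β γ ⟩
        0#                              ∎
      1F → k₁≡0
      2F → k₂≡0

  ⟪⟫-injective : ∀ {a b} → (∀ j → In (a j)) → (∀ j → In (b j)) → ⟪ a ⟫ ≡ ⟪ b ⟫ → ∀ j → a j ≡ b j
  ⟪⟫-injective {a} {b} a∈K b∈K ⟪a⟫≡⟪b⟫ j = x∙y⁻¹≈ε⇒x≈y (a j) (b j) (⟪⟫-independent (λ j → In-− (a∈K j) (b∈K j)) (begin
    ⟪ (λ j → a j - b j) ⟫ ≡⟨ solve 8 (λ a₀ a₁ a₂ b₀ b₁ b₂ β γ →
                               ((a₀ :- b₀) :+ (a₁ :- b₁) :* β) :+ (a₂ :- b₂) :* γ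
                               := ((a₀ :+ a₁ :* β) :+ a₂ :* γ) :- ((b₀ :+ b₁ :* β) :+ b₂ :* γ))
                             refl (a 0F) (a 1F) (a 2F) (b 0F) (b 1F) (b 2F) β γ ⟩
    ⟪ a ⟫ - ⟪ b ⟫         ≡⟨ x≈y⇒x∙y⁻¹≈ε ⟪a⟫≡⟪b⟫ ⟩
    0#                    ∎) j)

  ⟪⟫-zero : ∀ {k} → (∀ j → k j ≡ 0#) → ⟪ k ⟫ ≡ 0#
  ⟪⟫-zero {k} k≡0 = begin
    ⟪ k ⟫                  ≡⟨ cong₂ (λ a (bc : Carrier × Carrier) → (a + proj₁ bc * β) + proj₂ bc * γ) (k≡0 0F) (cong₂ _,_ (k≡0 1F) (k≡0 2F)) ⟩
    (0# + 0# * β) + 0# * γ ≡⟨ solve 2 (λ β γ → (:0 :+ :0 :* β) :+ :0 :* γ := :0) refl β γ ⟩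
    0#                     ∎

  record Expansion (y : Carrier) : Set where
    field
      coordinate : Fin 3 → Carrier
      coordinate∈K : ∀ j → In (coordinate j)
      expansion : y ≡ ⟪ coordinate ⟫

  -- 1, β, γ are independent over K, so the q′³ combinations with coefficients in K are all of F.
  expand : ∀ y → Expansion y
  expand y = let (i , j , l) , φijl≡y = injective⇒surjective sizeK³ sizeF φ φ-injective y
             in record { coordinate = κ i ∷ κ j ∷ κ l ∷ [] ; coordinate∈K = λ where 0F → κ∈K i ; 1F → κ∈K j ; 2F → κ∈K l
                       ; expansion = sym φijl≡y }
    where
    sizeK³ : HasSize (Fin q′ × Fin q′ × Fin q′) (q′ ^ 3)
    sizeK³ = subst (HasSize _) (cong (λ n → q′ ℕ.* (q′ ℕ.* n)) (sym (ℕ.*-identityʳ q′)))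
                   (×-size (Fin-size q′) (×-size (Fin-size q′) (Fin-size q′)))
    φ : Fin q′ × Fin q′ × Fin q′ → Carrier
    φ (i , j , l) = ⟪ κ i ∷ κ j ∷ κ l ∷ [] ⟫
    φ-injective : ∀ t t′ → φ t ≡ φ t′ → t ≡ t′
    φ-injective (i , j , l) (i′ , j′ , l′) φt≡φt′ =
      cong₂ _,_ (κ-injective i i′ (same 0F)) (cong₂ _,_ (κ-injective j j′ (same 1F)) (κ-injective l l′ (same 2F)))
      where
      same = ⟪⟫-injective {κ i ∷ κ j ∷ κ l ∷ []} {κ i′ ∷ κ j′ ∷ κ l′ ∷ []}
               (λ where 0F → κ∈K i ; 1F → κ∈K j ; 2F → κ∈K l) (λ where 0F → κ∈K i′ ; 1F → κ∈K j′ ; 2F → κ∈K l′) φt≡φt′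

  index-unique : ∀ {x} (x∈K : In x) {i} → x ≡ κ i → index x∈K ≡ i
  index-unique x∈K x≡κi = κ-injective _ _ (trans (κ∘index x∈K) x≡κi)

  σ : Fin q′ × Fin q′ → Fin q′ × Fin q′
  σ (i , j) = index (In-+ (κ∈K i) (κ∈K j)) , index (In-* (κ∈K i) (κ∈K j))

  record IrreducibleQuadratic : Set where
    field
      p r : Carrier
      p∈K : In p
      r∈K : In r
      no-root : ∀ a → In a → a * a + r ≢ p * a

  -- The map (a , b) ↦ (a + b , a b) on K² identifies (0 , 1) with (1 , 0), so it misses some (p , r).
  irreducible-quadratic : IrreducibleQuadratic
  irreducible-quadratic with surjective⊎missing sizeK² sizeK² (≡-dec Fin._≟_ Fin._≟_) σ
  ... | inj₁ σ-surjective = ⊥-elim (0≢1 (begin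
    0#           ≡⟨ sym (κ∘index In-0) ⟩
    κ (index In-0) ≡⟨ cong (λ t → κ (proj₁ t)) (surjective⇒injective sizeK² sizeK² σ σ-surjective _ _ σ-swap) ⟩
    κ (index In-1) ≡⟨ κ∘index In-1 ⟩
    1#           ∎))
    where
    σ-swap : σ (index In-0 , index In-1) ≡ σ (index In-1 , index In-0)
    σ-swap = cong₂ _,_ (index-unique _ (trans (+-comm _ _) (sym (κ∘index _))))
                       (index-unique _ (trans (*-comm _ _) (sym (κ∘index _))))
  ... | inj₂ ((i , j) , missed) = record { p = κ i ; r = κ j ; p∈K = κ∈K i ; r∈K = κ∈K j ; no-root = no-root }
    where
    no-root : ∀ a → In a → a * a + κ j ≢ κ i * a
    no-root a a∈K root = missed (index a∈K , index b∈K) (cong₂ _,_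
      (index-unique _ (trans (cong₂ _+_ (κ∘index a∈K) (κ∘index b∈K)) a+b≡p))
      (index-unique _ (trans (cong₂ _*_ (κ∘index a∈K) (κ∘index b∈K)) ab≡r)))
      where
      b = κ i - a
      b∈K = In-− (κ∈K i) a∈K
      a+b≡p : a + b ≡ κ i
      a+b≡p = solve 2 (λ a p → a :+ (p :- a) := p) refl a (κ i)
      ab≡r : a * b ≡ κ j
      ab≡r = begin
        a * (κ i - a)                  ≡⟨ solve 3 (λ a p r → a :* (p :- a) := p :* a :- (a :* a :+ r) :+ r) refl a (κ i) (κ j) ⟩
        κ i * a - (a * a + κ j) + κ j  ≡⟨ cong (λ t → κ i * a - t + κ j) root ⟩
        κ i * a - κ i * a + κ j        ≡⟨ solve 2 (λ s r → s :- s :+ r := r) refl (κ i * a) (κ j) ⟩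
        κ j                            ∎

  -- Representatives of the q′ + 1 points of the projective line over K.
  pair : Fin (suc q′) → Carrier × Carrier
  pair zero = 0# , 1#
  pair (suc k) = 1# , κ k

  pair-injective : ∀ j j′ {c} → c ≢ 0# →
    proj₁ (pair j) ≡ c * proj₁ (pair j′) → proj₂ (pair j) ≡ c * proj₂ (pair j′) → j ≡ j′
  pair-injective zero zero c≢0 _ _ = refl
  pair-injective zero (suc k′) {c} c≢0 0≡c*1 _ = ⊥-elim (c≢0 (trans (sym (*-identityʳ c)) (sym 0≡c*1)))
  pair-injective (suc k) zero {c} c≢0 1≡c*0 _ = ⊥-elim (1≢0 (trans 1≡c*0 (zeroʳ c)))
  pair-injective (suc k) (suc k′) {c} c≢0 1≡c*1 κk≡cκk′ = cong suc (κ-injective k k′ (begin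
    κ k       ≡⟨ κk≡cκk′ ⟩
    c * κ k′  ≡⟨ cong (_* κ k′) (trans (sym (*-identityʳ c)) (sym 1≡c*1)) ⟩
    1# * κ k′ ≡⟨ *-identityˡ (κ k′) ⟩
    κ k′      ∎))

  pair-surjective : ∀ {a b} → In a → In b → ¬ (a ≡ 0# × b ≡ 0#) →
    Σ (Fin (suc q′)) λ j → Σ Carrier λ c → c ≢ 0# × a ≡ c * proj₁ (pair j) × b ≡ c * proj₂ (pair j)
  pair-surjective {a} {b} a∈K b∈K ab≢0 with a ≟ 0#
  ... | yes a≡0 = zero , b , (λ b≡0 → ab≢0 (a≡0 , b≡0)) , trans a≡0 (sym (zeroʳ b)) , sym (*-identityʳ b)
  ... | no a≢0 = suc (index ba⁻¹∈K) , a , a≢0 , sym (*-identityʳ a) , (begin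
    b                           ≡⟨ solve 3 (λ a b a⁻¹ → b := a :* (b :* a⁻¹) :+ (:1 :- a :* a⁻¹) :* b) refl a b a⁻¹ ⟩
    a * (b * a⁻¹) + (1# - a * a⁻¹) * b ≡⟨ cong₂ (λ s t → a * s + (1# - t) * b) (sym (κ∘index ba⁻¹∈K)) aa⁻¹≡1 ⟩
    a * κ (index ba⁻¹∈K) + (1# - 1#) * b ≡⟨ solve 3 (λ a k b → a :* k :+ (:1 :- :1) :* b := a :* k) refl a (κ (index ba⁻¹∈K)) b ⟩
    a * κ (index ba⁻¹∈K)        ∎)
    where
    a⁻¹ = proj₁ (inverse a a≢0)
    aa⁻¹≡1 = proj₂ (inverse a a≢0)
    ba⁻¹∈K = In-* b∈K (In-⁻¹ a∈K aa⁻¹≡1)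

  pair∈K : ∀ j → In (proj₁ (pair j)) × In (proj₂ (pair j))
  pair∈K zero = In-0 , In-1
  pair∈K (suc k) = In-1 , κ∈K k

  module Points (l : EchelonLine) where
    open EchelonLine l

    point : Fin (suc q′) → V4 F
    point j = combination (proj₁ (pair j)) u (proj₂ (pair j)) v

    point-nonzero : ∀ j → NonZero F (point j)
    point-nonzero zero point≡0 = 1≢0 (trans (sym (combination-π₂ 0# 1#)) (point≡0 π₂))
    point-nonzero (suc k) point≡0 = 1≢0 (trans (sym (combination-π₁ 1# (κ k))) (point≡0 π₁))

    point-on-line : ∀ j → OnLine F K subLine (point j)
    point-on-line j = point-nonzero j , proj₁ (pair j) , proj₂ (pair j) , proj₁ (pair∈K j) , proj₂ (pair∈K j) , ∼-refl (point j)

    point-injective : ∀ j j′ → _∼_ F (point j) (point j′) → j ≡ j′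
    point-injective j j′ (c , c≢0 , j≡cj′) = pair-injective j j′ c≢0
      (trans (sym (combination-π₁ _ _)) (trans (j≡cj′ π₁) (cong (c *_) (combination-π₁ _ _))))
      (trans (sym (combination-π₂ _ _)) (trans (j≡cj′ π₂) (cong (c *_) (combination-π₂ _ _))))

    point-surjective : ∀ {x} → OnLine F K subLine x → Σ (Fin (suc q′)) λ j → _∼_ F x (point j)
    point-surjective {x} (x≢0 , a , b , a∈K , b∈K , x∼ab) with pair-surjective a∈K b∈K ab≢0
      where
      ab≢0 : ¬ (a ≡ 0# × b ≡ 0#)
      ab≢0 (a≡0 , b≡0) = x≢0 λ i → let c , _ , x≡c[ab] = x∼ab in begin
        x i                          ≡⟨ x≡c[ab] i ⟩
        c * (a * u i + b * v i)      ≡⟨ cong₂ (λ s t → c * (s * u i + t * v i)) a≡0 b≡0 ⟩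
        c * (0# * u i + 0# * v i)    ≡⟨ solve 3 (λ c u v → c :* (:0 :* u :+ :0 :* v) := :0) refl c (u i) (v i) ⟩
        0#                           ∎
    ... | j , s , s≢0 , a≡sp₁ , b≡sp₂ = j , ∼-trans x∼ab (s , s≢0 , λ i → begin
      a * u i + b * v i           ≡⟨ cong₂ (λ s t → s * u i + t * v i) a≡sp₁ b≡sp₂ ⟩
      s * p₁ * u i + s * p₂ * v i ≡⟨ solve 5 (λ s p₁ p₂ u v → s :* p₁ :* u :+ s :* p₂ :* v := s :* (p₁ :* u :+ p₂ :* v))
                                       refl s p₁ p₂ (u i) (v i) ⟩
      s * point j i               ∎)
      where
      p₁ = proj₁ (pair j)
      p₂ = proj₂ (pair j)

module FourLines {a ℓ} (R : RawRing a ℓ) (p r : RawRing.Carrier R) where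
  open RawRing R
  open Coordinates R

  u v : Fin 4 → Vector⁴
  u 0F = 1# ∷ 0# ∷ 0# ∷ 0# ∷ []
  u 1F = 0# ∷ 0# ∷ 1# ∷ 0# ∷ []
  u 2F = 1# ∷ 0# ∷ 1# ∷ 0# ∷ []
  u 3F = 1# ∷ 0# ∷ 0# ∷ 1# ∷ []
  v 0F = 0# ∷ 1# ∷ 0# ∷ 0# ∷ []
  v 1F = 0# ∷ 0# ∷ 0# ∷ 1# ∷ []
  v 2F = 0# ∷ 1# ∷ 0# ∷ 1# ∷ []
  v 3F = 0# ∷ 1# ∷ - r ∷ p ∷ []

  -- the point where line l meets the plane c · x = 0
  meet : Vector⁴ → Fin 4 → Vector⁴
  meet c l = combination (c · v l) (u l) (- (c · u l)) (v l)

  norm : Carrier → Carrier → Carrier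
  norm x y = (y * y + r * (x * x)) - p * (x * y)

  -- the three lines other than l meet the plane c · x = 0 in points whose cofactor is μ l c times c
  μ : Fin 4 → Vector⁴ → Carrier
  μ 0F c = ((((((c 1F * c 2F - c 1F * c 3F) + p * c 0F * c 3F) + p * c 2F * c 3F) - r * c 0F * c 2F) - r * c 2F * c 2F)
            - c 0F * c 3F) - c 3F * c 3F
  μ 1F c = ((((((c 1F * c 1F - r * c 1F * c 2F) - p * c 0F * c 1F) + c 1F * c 3F) - p * c 0F * c 3F) + r * c 0F * c 0F)
            + r * c 0F * c 2F) + r * c 0F * c 3F
  μ 2F c = (c 1F * c 3F - p * c 0F * c 3F) + r * c 0F * c 2F
  μ 3F c = c 1F * c 2F - c 0F * c 3F

module Construction (q′ : ℕ) (1<q′ : 1 ℕ.< q′) (F : Field) (K : Subfield F)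
                    (sizeF : HasSize (Field.Carrier F) (q′ ^ 3)) (sizeK : SubHasSize F K q′) where
  open FieldProperties F
  open SubfieldProperties F K
  open FiniteField q′ 1<q′ F K sizeF sizeK
  open IrreducibleQuadratic irreducible-quadratic
  open FourLines rawRing p r
  open Counting
  open ≡-Reasoning

  module Symbolic (k s : ℕ) where
    open Variables k (2 ℕ.+ s) public
    open FourLines (polynomialRing (k ℕ.* 4 ℕ.+ (2 ℕ.+ s))) (scalar 0F) (scalar 1F) public

  vector∈K : ∀ {a b c d} → In a → In b → In c → In d → ∀ i → In ((a ∷ b ∷ c ∷ d ∷ []) i)
  vector∈K a∈K b∈K c∈K d∈K = byCoordinate a∈K b∈K c∈K d∈K

  u∈K : ∀ l i → In (u l i)
  u∈K 0F = vector∈K In-1 In-0 In-0 In-0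
  u∈K 1F = vector∈K In-0 In-0 In-1 In-0
  u∈K 2F = vector∈K In-1 In-0 In-1 In-0
  u∈K 3F = vector∈K In-1 In-0 In-0 In-1
  v∈K : ∀ l i → In (v l i)
  v∈K 0F = vector∈K In-0 In-1 In-0 In-0
  v∈K 1F = vector∈K In-0 In-0 In-0 In-1
  v∈K 2F = vector∈K In-0 In-1 In-0 In-1
  v∈K 3F = vector∈K In-0 In-1 (In-- r∈K) p∈K

  pivot₁ pivot₂ : Fin 4 → Fin 4
  pivot₁ 1F = 2F
  pivot₁ _ = 0F
  pivot₂ 1F = 3F
  pivot₂ _ = 1F

  echelon : Fin 4 → EchelonLine
  echelon l = record
    { u = u l ; v = v l ; u∈K = u∈K l ; v∈K = v∈K l ; π₁ = pivot₁ l ; π₂ = pivot₂ l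
    ; u-π₁ = byCoordinate {P = λ l → u l (pivot₁ l) ≡ 1#} refl refl refl refl l
    ; v-π₁ = byCoordinate {P = λ l → v l (pivot₁ l) ≡ 0#} refl refl refl refl l
    ; u-π₂ = byCoordinate {P = λ l → u l (pivot₂ l) ≡ 0#} refl refl refl refl l
    ; v-π₂ = byCoordinate {P = λ l → v l (pivot₂ l) ≡ 1#} refl refl refl refl l }
  line : Fin 4 → SubLine F K
  line l = EchelonLine.subLine (echelon l)

  det₄-lines : ∀ i j → Carrier
  det₄-lines i j = det₄ (u i) (v i) (u j) (v j)

  private
    module S₀ = Symbolic 0 0

    ρ₀ : Vec.Vec Carrier 2
    ρ₀ = S₀.environment [] (p ∷ r ∷ [])

    module S₁ = Symbolic 1 0

    ρ₁ : V4 F → Vec.Vec Carrier 6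
    ρ₁ c = S₁.environment (c ∷ []) (p ∷ r ∷ [])

    c′ : Fin 4 → Polynomial 6
    c′ = S₁.vector 0F

    swapped : ∀ i j → det₄-lines i j ≢ 0# → det₄-lines j i ≢ 0#
    swapped i j Dij≢0 Dji≡0 = Dij≢0 (trans (det₄-swap (u i) (v i) (u j) (v j)) Dji≡0)

    ≡1⇒≢0 : ∀ {x} → x ≡ 1# → x ≢ 0#
    ≡1⇒≢0 x≡1 x≡0 = 1≢0 (trans (sym x≡1) x≡0)

    det₀₁≢0 : det₄-lines 0F 1F ≢ 0#
    det₀₁≢0 = ≡1⇒≢0 (prove ρ₀ (Poly.det₄ (S₀.u 0F) (S₀.v 0F) (S₀.u 1F) (S₀.v 1F)) :1 refl)

    det₀₂≢0 : det₄-lines 0F 2F ≢ 0#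
    det₀₂≢0 = ≡1⇒≢0 (prove ρ₀ (Poly.det₄ (S₀.u 0F) (S₀.v 0F) (S₀.u 2F) (S₀.v 2F)) :1 refl)

    det₀₃≢0 : det₄-lines 0F 3F ≢ 0#
    det₀₃≢0 D≡0 = no-root 0# In-0 (begin
      0# * 0# + r  ≡⟨ cong (0# * 0# +_) (trans (sym (prove ρ₀ (Poly.det₄ (S₀.u 0F) (S₀.v 0F) (S₀.u 3F) (S₀.v 3F)) (S₀.scalar 1F) refl)) D≡0) ⟩
      0# * 0# + 0# ≡⟨ solve 1 (λ p → :0 :* :0 :+ :0 := p :* :0) refl p ⟩
      p * 0#       ∎)

    det₁₂≢0 : det₄-lines 1F 2F ≢ 0#
    det₁₂≢0 = ≡1⇒≢0 (prove ρ₀ (Poly.det₄ (S₀.u 1F) (S₀.v 1F) (S₀.u 2F) (S₀.v 2F)) :1 refl)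

    det₁₃≢0 : det₄-lines 1F 3F ≢ 0#
    det₁₃≢0 = ≡1⇒≢0 (prove ρ₀ (Poly.det₄ (S₀.u 1F) (S₀.v 1F) (S₀.u 3F) (S₀.v 3F)) :1 refl)

    det₂₃≢0 : det₄-lines 2F 3F ≢ 0#
    det₂₃≢0 D≡0 = no-root 1# In-1 (x∙y⁻¹≈ε⇒x≈y _ _ (trans
      (prove ρ₀ (:1 :* :1 :+ S₀.scalar 1F :- S₀.scalar 0F :* :1) (Poly.det₄ (S₀.u 2F) (S₀.v 2F) (S₀.u 3F) (S₀.v 3F)) refl) D≡0))

  det₄-lines≢0 : ∀ i j → i ≢ j → det₄-lines i j ≢ 0#
  det₄-lines≢0 0F 1F _ = det₀₁≢0
  det₄-lines≢0 0F 2F _ = det₀₂≢0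
  det₄-lines≢0 0F 3F _ = det₀₃≢0
  det₄-lines≢0 1F 2F _ = det₁₂≢0
  det₄-lines≢0 1F 3F _ = det₁₃≢0
  det₄-lines≢0 2F 3F _ = det₂₃≢0
  det₄-lines≢0 1F 0F _ = swapped 0F 1F det₀₁≢0
  det₄-lines≢0 2F 0F _ = swapped 0F 2F det₀₂≢0
  det₄-lines≢0 3F 0F _ = swapped 0F 3F det₀₃≢0
  det₄-lines≢0 2F 1F _ = swapped 1F 2F det₁₂≢0
  det₄-lines≢0 3F 1F _ = swapped 1F 3F det₁₃≢0
  det₄-lines≢0 3F 2F _ = swapped 2F 3F det₂₃≢0
  det₄-lines≢0 0F 0F 0≢0 = ⊥-elim (0≢0 refl)
  det₄-lines≢0 1F 1F 1≢1 = ⊥-elim (1≢1 refl)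
  det₄-lines≢0 2F 2F 2≢2 = ⊥-elim (2≢2 refl)
  det₄-lines≢0 3F 3F 3≢3 = ⊥-elim (3≢3 refl)

  skew : ∀ i j → i ≢ j → Skew F K (line i) (line j)
  skew i j i≢j = det₄≢0⇒skew (line i) (line j) (det₄-lines≢0 i j i≢j)

  point : Fin 4 × Fin (suc q′) → V4 F
  point (l , j) = Points.point (echelon l) j

  point-injective : ∀ s t → _∼_ F (point s) (point t) → s ≡ t
  point-injective (l , j) (l′ , j′) s∼t with l Fin.≟ l′
  ... | yes refl = cong (l ,_) (Points.point-injective (echelon l) j j′ s∼t)
  ... | no l≢l′ = ⊥-elim (skew l l′ l≢l′ (point (l , j)) (Points.point-on-line (echelon l) j)
                    (OnLine-resp-∼ {line l′} s∼t (Points.point-nonzero (echelon l) j) (Points.point-on-line (echelon l′) j′)))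

  point-count : HasPointCount F (UnionOf F K line) (4 ℕ.* q′ ℕ.+ 4)
  point-count = (λ k → point (e k)) , (λ k → on-union (e k)) , (λ k k′ ek∼ek′ → e-injective k k′ (point-injective _ _ ek∼ek′)) ,
    λ x x≢0 (l , x∈l) →
      let j , x∼point = Points.point-surjective (echelon l) x∈l
          k , ek≡lj = e-surjective (l , j)
      in k , subst (λ t → _∼_ F x (point t)) (sym ek≡lj) x∼point
    where
    4[1+q′]≡4q′+4 : 4 ℕ.* suc q′ ≡ 4 ℕ.* q′ ℕ.+ 4
    4[1+q′]≡4q′+4 = trans (ℕ.*-suc 4 q′) (ℕ.+-comm 4 (4 ℕ.* q′))
    size : HasSize (Fin 4 × Fin (suc q′)) (4 ℕ.* q′ ℕ.+ 4)
    size = subst (HasSize _) 4[1+q′]≡4q′+4 (×-size (Fin-size 4) (Fin-size (suc q′)))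
    e = proj₁ size
    e-injective = proj₁ (proj₂ size)
    e-surjective = proj₂ (proj₂ size)
    on-union : ∀ t → NonZero F (point t) × UnionOf F K line (point t)
    on-union (l , j) = Points.point-nonzero (echelon l) j , l , Points.point-on-line (echelon l) j

  cofactor-meet : ∀ l c t →
    cofactor (meet c (punchIn l 0F)) (meet c (punchIn l 1F)) (meet c (punchIn l 2F)) t ≡ μ l c * c t
  cofactor-meet l c = coordinatewise l
    where
    ρ = ρ₁ c
    L R : Fin 4 → Fin 4 → Polynomial 6
    L l t = Poly.cofactor (S₁.meet c′ (punchIn l 0F)) (S₁.meet c′ (punchIn l 1F)) (S₁.meet c′ (punchIn l 2F)) t
    R l t = S₁.μ l c′ :* c′ t
    coordinatewise : ∀ l t →
      cofactor (meet c (punchIn l 0F)) (meet c (punchIn l 1F)) (meet c (punchIn l 2F)) t ≡ μ l c * c t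
    coordinatewise 0F = byCoordinate (prove ρ (L 0F 0F) (R 0F 0F) refl) (prove ρ (L 0F 1F) (R 0F 1F) refl)
                                    (prove ρ (L 0F 2F) (R 0F 2F) refl) (prove ρ (L 0F 3F) (R 0F 3F) refl)
    coordinatewise 1F = byCoordinate (prove ρ (L 1F 0F) (R 1F 0F) refl) (prove ρ (L 1F 1F) (R 1F 1F) refl)
                                    (prove ρ (L 1F 2F) (R 1F 2F) refl) (prove ρ (L 1F 3F) (R 1F 3F) refl)
    coordinatewise 2F = byCoordinate (prove ρ (L 2F 0F) (R 2F 0F) refl) (prove ρ (L 2F 1F) (R 2F 1F) refl)
                                    (prove ρ (L 2F 2F) (R 2F 2F) refl) (prove ρ (L 2F 3F) (R 2F 3F) refl)
    coordinatewise 3F = byCoordinate (prove ρ (L 3F 0F) (R 3F 0F) refl) (prove ρ (L 3F 1F) (R 3F 1F) refl)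
                                    (prove ρ (L 3F 2F) (R 3F 2F) refl) (prove ρ (L 3F 3F) (R 3F 3F) refl)

  norm≢0 : ∀ {x y} → In x → In y → ¬ (x ≡ 0# × y ≡ 0#) → norm x y ≢ 0#
  norm≢0 {x} {y} x∈K y∈K xy≢0 norm≡0 with x ≟ 0#
  ... | yes x≡0 = x≢0∧y≢0⇒x*y≢0 y≢0 y≢0 (begin
    y * y      ≡⟨ solve 3 (λ y p r → y :* y := (y :* y :+ r :* (:0 :* :0)) :- p :* (:0 :* y)) refl y p r ⟩
    norm 0# y  ≡⟨ cong (λ z → norm z y) (sym x≡0) ⟩
    norm x y   ≡⟨ norm≡0 ⟩
    0#         ∎)
    where
    y≢0 : y ≢ 0#
    y≢0 y≡0 = xy≢0 (x≡0 , y≡0)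
  ... | no x≢0 = no-root t t∈K (x∙y⁻¹≈ε⇒x≈y _ _ (x≢0∧x*y≡0⇒y≡0 (x≢0∧y≢0⇒x*y≢0 x≢0 x≢0) (begin
    (x * x) * ((t * t + r) - p * t)
      ≡⟨ solve 5 (λ x y x⁻¹ p r → (x :* x) :* (((y :* x⁻¹) :* (y :* x⁻¹) :+ r) :- p :* (y :* x⁻¹))
                                  := (y :* y :* (x :* x⁻¹) :* (x :* x⁻¹) :+ r :* (x :* x)) :- p :* (x :* y) :* (x :* x⁻¹))
           refl x y x⁻¹ p r ⟩
    (y * y * (x * x⁻¹) * (x * x⁻¹) + r * (x * x)) - p * (x * y) * (x * x⁻¹)
      ≡⟨ cong (λ e → (y * y * e * e + r * (x * x)) - p * (x * y) * e) xx⁻¹≡1 ⟩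
    (y * y * 1# * 1# + r * (x * x)) - p * (x * y) * 1#
      ≡⟨ solve 4 (λ x y p r → (y :* y :* :1 :* :1 :+ r :* (x :* x)) :- p :* (x :* y) :* :1
                              := (y :* y :+ r :* (x :* x)) :- p :* (x :* y)) refl x y p r ⟩
    norm x y
      ≡⟨ norm≡0 ⟩
    0# ∎)))
    where
    x⁻¹ = proj₁ (inverse x x≢0)
    xx⁻¹≡1 = proj₂ (inverse x x≢0)
    t = y * x⁻¹
    t∈K = In-* y∈K (In-⁻¹ x∈K xx⁻¹≡1)

  -- If c₀ = c₁ = 0 or c₂ = c₃ = 0 then ±μ is the norm of the other pair; otherwise μ 3F c or μ 2F c works.
  μ≢0 : ∀ c → (∀ i → In (c i)) → NonZero F c → Σ (Fin 4) λ l → μ l c ≢ 0#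
  μ≢0 c c∈K c≢0 with (c 0F ≟ 0#) ×-dec (c 1F ≟ 0#) | (c 2F ≟ 0#) ×-dec (c 3F ≟ 0#)
  ... | yes (c₀≡0 , c₁≡0) | yes (c₂≡0 , c₃≡0) = ⊥-elim (c≢0 (byCoordinate c₀≡0 c₁≡0 c₂≡0 c₃≡0))
  ... | yes (c₀≡0 , c₁≡0) | no c₂₃≢0 = 0F , λ μ≡0 → norm≢0 (c∈K 2F) (c∈K 3F) c₂₃≢0 (begin
    norm (c 2F) (c 3F)                  ≡⟨ prove (ρ₁ c) (S₁.norm (c′ 2F) (c′ 3F)) (:- S₁.μ 0F (:0 ∷ :0 ∷ c′ 2F ∷ c′ 3F ∷ [])) refl ⟩
    - μ 0F (0# ∷ 0# ∷ c 2F ∷ c 3F ∷ []) ≡⟨ cong₂ (λ a b → - μ 0F (a ∷ b ∷ c 2F ∷ c 3F ∷ [])) (sym c₀≡0) (sym c₁≡0) ⟩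
    - μ 0F c                            ≡⟨ cong -_ μ≡0 ⟩
    - 0#                                ≡⟨ -0#≈0# ⟩
    0#                                  ∎)
  ... | no c₀₁≢0 | yes (c₂≡0 , c₃≡0) = 1F , λ μ≡0 → norm≢0 (c∈K 0F) (c∈K 1F) c₀₁≢0 (begin
    norm (c 0F) (c 1F)                  ≡⟨ prove (ρ₁ c) (S₁.norm (c′ 0F) (c′ 1F)) (S₁.μ 1F (c′ 0F ∷ c′ 1F ∷ :0 ∷ :0 ∷ [])) refl ⟩
    μ 1F (c 0F ∷ c 1F ∷ 0# ∷ 0# ∷ [])   ≡⟨ cong₂ (λ a b → μ 1F (c 0F ∷ c 1F ∷ a ∷ b ∷ [])) (sym c₂≡0) (sym c₃≡0) ⟩
    μ 1F c                              ≡⟨ μ≡0 ⟩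
    0#                                  ∎)
  ... | no c₀₁≢0 | no c₂₃≢0 with (c 0F * c 3F - c 1F * c 2F) ≟ 0#
  ...   | no d≢0 = 3F , λ μ≡0 → d≢0 (begin
    c 0F * c 3F - c 1F * c 2F           ≡⟨ prove (ρ₁ c) (c′ 0F :* c′ 3F :- c′ 1F :* c′ 2F) (:- S₁.μ 3F c′) refl ⟩
    - μ 3F c                            ≡⟨ cong -_ μ≡0 ⟩
    - 0#                                ≡⟨ -0#≈0# ⟩
    0#                                  ∎)
  ...   | yes d≡0 = 2F , λ μ≡0 → c₂₃≢0 (vanishes (c 2F) (c 0F) (p * c 0F - c 1F) μ≡0
      (prove (ρ₁ c) (N′ :* c′ 2F) (c′ 0F :* S₁.μ 2F c′ :+ (S₁.scalar 0F :* c′ 0F :- c′ 1F) :* d′) refl) ,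
                                          vanishes (c 3F) (c 1F) (r * c 0F) μ≡0
      (prove (ρ₁ c) (N′ :* c′ 3F) (c′ 1F :* S₁.μ 2F c′ :+ (S₁.scalar 1F :* c′ 0F) :* d′) refl))
    where
    N′ d′ : Polynomial 6
    N′ = S₁.norm (c′ 0F) (c′ 1F)
    d′ = c′ 0F :* c′ 3F :- c′ 1F :* c′ 2F
    -- N(c₀, c₁) c₂ and N(c₀, c₁) c₃ are combinations of μ 2F c and c₀ c₃ − c₁ c₂, which both vanish
    vanishes : ∀ z a b → μ 2F c ≡ 0# → norm (c 0F) (c 1F) * z ≡ a * μ 2F c + b * (c 0F * c 3F - c 1F * c 2F) → z ≡ 0#
    vanishes z a b μ≡0 Nz≡ = x≢0∧x*y≡0⇒y≡0 (norm≢0 (c∈K 0F) (c∈K 1F) c₀₁≢0) (begin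
      norm (c 0F) (c 1F) * z                         ≡⟨ Nz≡ ⟩
      a * μ 2F c + b * (c 0F * c 3F - c 1F * c 2F)   ≡⟨ cong₂ (λ m d → a * m + b * d) μ≡0 d≡0 ⟩
      a * 0# + b * 0#                                ≡⟨ solve 2 (λ a b → a :* :0 :+ b :* :0 := :0) refl a b ⟩
      0#                                             ∎)

  -- Expanding the coordinates of x in the basis 1, β, γ gives three K-linear equations in four
  -- unknowns; a nonzero K-rational solution c satisfies c · x = 0.
  plane-through : ∀ x → Σ (V4 F) λ c → (∀ i → In (c i)) × NonZero F c × c · x ≡ 0#
  plane-through x = c , c∈K , c≢0 , (begin
    c · x                                   ≡⟨ ·-congʳ c (λ i → Expansion.expansion (expand (x i))) ⟩
    c · (λ i → ⟪ (λ j → A j i) ⟫)           ≡⟨ prove ρ (c″ Poly.· (λ i → ⟪ (λ j → A′ j i) ⟫′)) ⟪ (λ j → Σ′ j) ⟫′ refl ⟩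
    ⟪ (λ j → sumF F (λ i → A j i * c i)) ⟫  ≡⟨ ⟪⟫-zero c-solves ⟩
    0#                                      ∎)
    where
    A : Fin 3 → Fin 4 → Carrier
    A j i = Expansion.coordinate (expand (x i)) j
    kernel = nontrivial-kernel _≟_ 3 4 (s≤s (s≤s (s≤s (s≤s z≤n)))) A (λ j i → Expansion.coordinate∈K (expand (x i)) j)
    c = proj₁ kernel
    c∈K = proj₁ (proj₂ kernel)
    c≢0 = proj₁ (proj₂ (proj₂ kernel))
    c-solves = proj₂ (proj₂ (proj₂ kernel))
    open Variables 4 2
    ρ = environment (A 0F ∷ A 1F ∷ A 2F ∷ c ∷ []) (β ∷ γ ∷ [])
    A′ : Fin 3 → Fin 4 → Polynomial 18
    A′ j = vector (punchIn 3F j)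
    c″ : Fin 4 → Polynomial 18
    c″ = vector 3F
    ⟪_⟫′ : (Fin 3 → Polynomial 18) → Polynomial 18
    ⟪ k ⟫′ = (k 0F :+ k 1F :* scalar 0F) :+ k 2F :* scalar 1F
    Σ′ : Fin 3 → Polynomial 18
    Σ′ j = A′ j 0F :* c″ 0F :+ (A′ j 1F :* c″ 1F :+ (A′ j 2F :* c″ 2F :+ (A′ j 3F :* c″ 3F :+ :0)))

  meet-on-line : ∀ {c} → (∀ i → In (c i)) → ∀ l → NonZero F (meet c l) → OnLine F K (line l) (meet c l)
  meet-on-line {c} c∈K l meet≢0 =
    meet≢0 , c · v l , - (c · u l) , ·-In c∈K (v∈K l) , In-- (·-In c∈K (u∈K l)) , ∼-refl (meet c l)

  meets-span : ∀ {x c} → (∀ i → In (c i)) → NonZero F c → c · x ≡ 0# → ∀ l → μ l c ≢ 0# →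
    Σ (Fin 3 → V4 F) λ s → (∀ j → NonZero F (s j) × UnionOf F K line (s j)) × InSpan F x s
  meets-span {x} {c} c∈K c≢0 c·x≡0 l μ≢0 = s₀ ∷ s₁ ∷ s₂ ∷ [] , members , cramer cofactor≢0 _≟_ det≡0
    where
    s₀ = meet c (punchIn l 0F)
    s₁ = meet c (punchIn l 1F)
    s₂ = meet c (punchIn l 2F)
    cofactor≢0 : NonZero F (cofactor s₀ s₁ s₂)
    cofactor≢0 cofactor≡0 = c≢0 λ t → x≢0∧x*y≡0⇒y≡0 μ≢0 (trans (sym (cofactor-meet l c t)) (cofactor≡0 t))
    det≡0 : det₄ s₀ s₁ s₂ x ≡ 0#
    det≡0 = begin
      cofactor s₀ s₁ s₂ · x      ≡⟨ ·-congˡ x (cofactor-meet l c) ⟩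
      (λ t → μ l c * c t) · x    ≡⟨ ·-scaleˡ (μ l c) c x ⟩
      μ l c * (c · x)            ≡⟨ cong (μ l c *_) c·x≡0 ⟩
      μ l c * 0#                 ≡⟨ zeroʳ (μ l c) ⟩
      0#                         ∎
    members : ∀ j → NonZero F ((s₀ ∷ s₁ ∷ s₂ ∷ []) j) × UnionOf F K line ((s₀ ∷ s₁ ∷ s₂ ∷ []) j)
    members 0F = cofactor≢0⇒nonzero₁ cofactor≢0 , punchIn l 0F , meet-on-line c∈K (punchIn l 0F) (cofactor≢0⇒nonzero₁ cofactor≢0)
    members 1F = cofactor≢0⇒nonzero₂ cofactor≢0 , punchIn l 1F , meet-on-line c∈K (punchIn l 1F) (cofactor≢0⇒nonzero₂ cofactor≢0)
    members 2F = cofactor≢0⇒nonzero₃ cofactor≢0 , punchIn l 2F , meet-on-line c∈K (punchIn l 2F) (cofactor≢0⇒nonzero₃ cofactor≢0)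

  2-covering : Covering F (UnionOf F K line) 2
  2-covering x _ =
    let c , c∈K , c≢0 , c·x≡0 = plane-through x
        l , μ≢0′ = μ≢0 c c∈K c≢0
    in meets-span c∈K c≢0 c·x≡0 l μ≢0′

  x₀ : V4 F
  x₀ = 1# ∷ β ∷ γ ∷ 0# ∷ []

  -- Expanding α and α′ in the basis 1, β, γ turns x₀ = α w + α′ w′ into an identity matrix of rank at most two.
  x₀∉secant : ∀ α α′ {w w′ : V4 F} → (∀ i → In (w i)) → (∀ i → In (w′ i)) → ¬ (∀ i → x₀ i ≡ α * w i + α′ * w′ i)
  x₀∉secant α α′ {w} {w′} w∈K w′∈K x₀≡αw+α′w′ = 1≢0 (begin
    1#                                ≡⟨ solve 0 (:1 := Poly.det₃ :1 :0 :0 :0 :1 :0 :0 :0 :1) refl ⟩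
    det₃ 1# 0# 0# 0# 1# 0# 0# 0# 1#   ≡⟨ sym (det₃-cong (M≡ 0F 0F) (M≡ 0F 1F) (M≡ 0F 2F) (M≡ 1F 0F) (M≡ 1F 1F) (M≡ 1F 2F)
                                                        (M≡ 2F 0F) (M≡ 2F 1F) (M≡ 2F 2F)) ⟩
    det₃ (M 0F 0F) (M 0F 1F) (M 0F 2F) (M 1F 0F) (M 1F 1F) (M 1F 2F) (M 2F 0F) (M 2F 1F) (M 2F 2F)
                                      ≡⟨ det₃-rank≤2 a a′ (λ i → w (inject₁ i)) (λ i → w′ (inject₁ i)) ⟩
    0#                                ∎)
    where
    open Expansion (expand α) renaming (coordinate to a; coordinate∈K to a∈K; expansion to α≡⟪a⟫)
    open Expansion (expand α′) renaming (coordinate to a′; coordinate∈K to a′∈K; expansion to α′≡⟪a′⟫)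
    M : Fin 3 → Fin 3 → Carrier
    M i j = w (inject₁ i) * a j + w′ (inject₁ i) * a′ j
    e : Fin 3 → Fin 3 → Carrier
    e 0F = 1# ∷ 0# ∷ 0# ∷ []
    e 1F = 0# ∷ 1# ∷ 0# ∷ []
    e 2F = 0# ∷ 0# ∷ 1# ∷ []
    e∈K : ∀ i j → In (e i j)
    e∈K 0F = λ where 0F → In-1 ; 1F → In-0 ; 2F → In-0
    e∈K 1F = λ where 0F → In-0 ; 1F → In-1 ; 2F → In-0
    e∈K 2F = λ where 0F → In-0 ; 1F → In-0 ; 2F → In-1
    x₀≡⟪e⟫ : ∀ i → x₀ (inject₁ i) ≡ ⟪ e i ⟫
    x₀≡⟪e⟫ 0F = solve 2 (λ β γ → :1 := (:1 :+ :0 :* β) :+ :0 :* γ) refl β γ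
    x₀≡⟪e⟫ 1F = solve 2 (λ β γ → β := (:0 :+ :1 :* β) :+ :0 :* γ) refl β γ
    x₀≡⟪e⟫ 2F = solve 2 (λ β γ → γ := (:0 :+ :0 :* β) :+ :1 :* γ) refl β γ
    ⟪M⟫≡x₀ : ∀ i → ⟪ M i ⟫ ≡ x₀ (inject₁ i)
    ⟪M⟫≡x₀ i = begin
      ⟪ M i ⟫                      ≡⟨ solve 10 (λ w w′ a₀ a₁ a₂ a′₀ a′₁ a′₂ β γ →
                                        ((w :* a₀ :+ w′ :* a′₀) :+ (w :* a₁ :+ w′ :* a′₁) :* β) :+ (w :* a₂ :+ w′ :* a′₂) :* γ
                                        := ((a₀ :+ a₁ :* β) :+ a₂ :* γ) :* w :+ ((a′₀ :+ a′₁ :* β) :+ a′₂ :* γ) :* w′)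
                                      refl (w (inject₁ i)) (w′ (inject₁ i)) (a 0F) (a 1F) (a 2F) (a′ 0F) (a′ 1F) (a′ 2F) β γ ⟩
      ⟪ a ⟫ * w (inject₁ i) + ⟪ a′ ⟫ * w′ (inject₁ i) ≡⟨ cong₂ (λ s t → s * w (inject₁ i) + t * w′ (inject₁ i)) (sym α≡⟪a⟫) (sym α′≡⟪a′⟫) ⟩
      α * w (inject₁ i) + α′ * w′ (inject₁ i)         ≡⟨ sym (x₀≡αw+α′w′ (inject₁ i)) ⟩
      x₀ (inject₁ i)               ∎
    M≡ : ∀ i j → M i j ≡ e i j
    M≡ i = ⟪⟫-injective (λ j → In-+ (In-* (w∈K (inject₁ i)) (a∈K j)) (In-* (w′∈K (inject₁ i)) (a′∈K j))) (e∈K i)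
             (trans (⟪M⟫≡x₀ i) (x₀≡⟪e⟫ i))

  K-representative : ∀ {y} → UnionOf F K line y →
    Σ Carrier λ c → Σ (V4 F) λ w → (∀ i → In (w i)) × (∀ i → y i ≡ c * w i)
  K-representative (l , _ , a , b , a∈K , b∈K , c , _ , y≡c[au+bv]) =
    c , combination a (u l) b (v l) , (λ i → In-+ (In-* a∈K (u∈K l i)) (In-* b∈K (v∈K l i))) , y≡c[au+bv]

  not-1-covering : ∀ ρ′ → ρ′ ℕ.< 2 → ¬ Covering F (UnionOf F K line) ρ′
  not-1-covering 0 _ covers =
    let s , s∈S , coefficient , x₀≡ = covers x₀ (λ x₀≡0 → 1≢0 (x₀≡0 0F))
        c , w , w∈K , s≡cw = K-representative (proj₂ (s∈S 0F))
    in x₀∉secant (coefficient 0F * c) 0# w∈K w∈K λ i → begin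
      x₀ i                                 ≡⟨ x₀≡ i ⟩
      coefficient 0F * s 0F i + 0#         ≡⟨ cong (λ t → coefficient 0F * t + 0#) (s≡cw i) ⟩
      coefficient 0F * (c * w i) + 0#      ≡⟨ solve 3 (λ a c w → a :* (c :* w) :+ :0 := (a :* c) :* w :+ :0 :* w)
                                                refl (coefficient 0F) c (w i) ⟩
      (coefficient 0F * c) * w i + 0# * w i ∎
  not-1-covering 1 _ covers =
    let s , s∈S , coefficient , x₀≡ = covers x₀ (λ x₀≡0 → 1≢0 (x₀≡0 0F))
        c , w , w∈K , s₀≡cw = K-representative (proj₂ (s∈S 0F))
        c′ , w′ , w′∈K , s₁≡c′w′ = K-representative (proj₂ (s∈S 1F))
    in x₀∉secant (coefficient 0F * c) (coefficient 1F * c′) w∈K w′∈K λ i → begin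
      x₀ i
        ≡⟨ x₀≡ i ⟩
      coefficient 0F * s 0F i + (coefficient 1F * s 1F i + 0#)
        ≡⟨ cong₂ (λ t t′ → coefficient 0F * t + (coefficient 1F * t′ + 0#)) (s₀≡cw i) (s₁≡c′w′ i) ⟩
      coefficient 0F * (c * w i) + (coefficient 1F * (c′ * w′ i) + 0#)
        ≡⟨ solve 6 (λ a c w a′ c′ w′ → a :* (c :* w) :+ (a′ :* (c′ :* w′) :+ :0) := (a :* c) :* w :+ (a′ :* c′) :* w′)
             refl (coefficient 0F) c (w i) (coefficient 1F) c′ (w′ i) ⟩
      (coefficient 0F * c) * w i + (coefficient 1F * c′) * w′ i
        ∎
  not-1-covering (suc (suc _)) (s≤s (s≤s ()))

  saturating : Saturating F (UnionOf F K line) 2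
  saturating = 2-covering , not-1-covering

open import Data.Nat using (_*_; _+_)

prime-power>1 : ∀ {q} → IsPrimePower q → 1 ℕ.< q
prime-power>1 (p , k , p-prime , q≡p^[1+k]) =
  subst (1 ℕ.<_) (sym q≡p^[1+k]) (ℕ.^-monoʳ-< p (ℕ.nonTrivial⇒n>1 p {{prime⇒nonTrivial p-prime}}) {0} {ℕ.suc k} (ℕ.s≤s ℕ.z≤n))

corollary4 : (q' : ℕ) → IsPrimePower q' →
    (F : Field) (K : Subfield F) →
    HasSize (Field.Carrier F) (q' ^ 3) → SubHasSize F K q' →
    Σ (Fin 4 → SubLine F K) λ L →
      (∀ i j → i ≢ j → Skew F K (L i) (L j)) ×
      HasPointCount F (UnionOf F K L) (4 * q' + 4) ×
      Saturating F (UnionOf F K L) 2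
corollary4 q' q'-prime-power F K sizeF sizeK = line , skew , point-count , saturating
  where open Construction q' (prime-power>1 q'-prime-power) F K sizeF sizeK
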